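{- The number of $9$-caps of dimension $6$ in $\mathbb{Z}_2^n$ satisfies $Q_6(9,n)=\frac{35}{9}\,Q_6(7,n)$.
   Context: $\mathbb{Z}_2^n$ is the $n$-dimensional vector space over $\mathbb{Z}_2$. A quad is a set of four distinct elements $a,b,c,d$ with $a+b+c+d=\vec 0$; a cap is a subset containing no quad; a $k$-cap is a cap with $k$ elements. Over $\mathbb{Z}_2$, affine combinations are sums of an odd number of elements and $\mathrm{aff}(S)$ is the set of affine combinations of elements of $S$. The dimension of a cap $C$ is the dimension of the flat $\mathrm{aff}(C)$. $Q_r(k,n)$ denotes the number of $k$-caps in $\mathbb{Z}_2^n$ of dimension $r$ (so $Q_6(7,n)$ counts the affinely independent $7$-element subsets). -}

module Defs where

open import Data.Bool using (Bool; true; false; _xor_)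
open import Data.Bool.Properties using () renaming (_≟_ to _≟B_)
open import Data.Nat using (ℕ; zero; suc; _%_; _^_)
open import Data.Nat.Properties using () renaming (_≟_ to _≟ℕ_)
open import Data.Vec using (Vec; []; _∷_; zipWith; replicate)
open import Data.Vec.Properties using (≡-dec)
open import Data.List using (List; []; _∷_; [_]; map; _++_; foldr; length; filter)
open import Data.List.Relation.Unary.All using (All)
import Data.List.Relation.Unary.All as All
open import Data.List.Relation.Unary.Any using (Any)
import Data.List.Relation.Unary.Any as Any
open import Data.Product using (_×_)
open import Relation.Nullary using (¬_; Dec)
open import Relation.Nullary.Decidable using (_×-dec_; ¬?)
open import Relation.Binary.PropositionalEquality using (_≡_; _≢_)

Pt : ℕ → Set
Pt n = Vec Bool n

_⊕_ : ∀ {n} → Pt n → Pt n → Pt n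
_⊕_ = zipWith _xor_

𝟎 : ∀ {n} → Pt n
𝟎 = replicate _ false

_≟P_ : ∀ {n} (u v : Pt n) → Dec (u ≡ v)
_≟P_ = ≡-dec _≟B_

sumL : ∀ {n} → List (Pt n) → Pt n
sumL = foldr _⊕_ 𝟎

allPts : (n : ℕ) → List (Pt n)
allPts zero = [ [] ]
allPts (suc n) = map (false ∷_) (allPts n) ++ map (true ∷_) (allPts n)

sublists : ∀ {a} {A : Set a} → List A → List (List A)
sublists [] = [ [] ]
sublists (x ∷ xs) = map (x ∷_) (sublists xs) ++ sublists xs

-- All sublists of length exactly k.  Applied to a duplicate-free list,
-- this enumerates each k-element subset exactly once.
choose : ∀ {a} {A : Set a} → ℕ → List A → List (List A)
choose zero _ = [ [] ]
choose (suc k) [] = []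
choose (suc k) (x ∷ xs) = map (x ∷_) (choose k xs) ++ choose (suc k) xs

-- A (duplicate-free) set C is a cap iff no four distinct elements of C sum to 0.
IsCap : ∀ {n} → List (Pt n) → Set
IsCap C = All (λ q → sumL q ≢ 𝟎) (choose 4 C)

isCap? : ∀ {n} (C : List (Pt n)) → Dec (IsCap C)
isCap? C = All.all? (λ q → ¬? (sumL q ≟P 𝟎)) (choose 4 C)

-- v ∈ aff(C): v is the sum of an odd number of (distinct) elements of C.
InAff : ∀ {n} → List (Pt n) → Pt n → Set
InAff C v = Any (λ s → (length s % 2 ≡ 1) × (sumL s ≡ v)) (sublists C)

inAff? : ∀ {n} (C : List (Pt n)) (v : Pt n) → Dec (InAff C v)
inAff? C v = Any.any? (λ s → ((length s % 2) ≟ℕ 1) ×-dec (sumL s ≟P v)) (sublists C)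

aff : ∀ {n} → List (Pt n) → List (Pt n)
aff {n} C = filter (inAff? C) (allPts n)

-- C has dimension r iff the flat aff(C) has dimension r, i.e. |aff(C)| = 2^r.
HasDim : ∀ {n} → ℕ → List (Pt n) → Set
HasDim r C = length (aff C) ≡ 2 ^ r

hasDim? : ∀ {n} (r : ℕ) (C : List (Pt n)) → Dec (HasDim r C)
hasDim? r C = length (aff C) ≟ℕ (2 ^ r)

Q : ℕ → ℕ → ℕ → ℕ
Q r k n = length (filter (λ C → isCap? C ×-dec hasDim? r C) (choose k (allPts n)))

{-# OPTIONS --safe #-}
module Submission where

-- Double count the pairs (S, K) where K is a 9-cap of dimension 6 and S ⊆ K is an affinely
-- independent 7-set (equivalently, a 7-cap of dimension 6).  Every such K contains exactly 27 such S
-- and every such S lies in exactly 105 such K, so 27 · Q₆(9,n) = 105 · Q₆(7,n).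
--
-- Both numbers are computed in coordinates.  If B is an affinely independent list, every point of
-- aff B is the sum of a unique odd subfamily of B, i.e. of a unique odd-weight mask over B, and sums of
-- subfamilies of points of aff B correspond to sums of the masks.  A 9-cap K of dimension 6 is an
-- affine basis B of size 7 plus two points with odd masks m, m′ ∈ ℤ₂⁷, and an independent 7-set S is
-- extended to such a K by a pair of points of aff S with odd masks m, m′.  Caps and independence can be
-- read off the masks, so both counts become finite computations over pairs of odd masks in ℤ₂⁷.
-- The extensions of S are counted as ordered pairs of points, which gives 210 = 2 · 105.

open import Defs
open import Algebra.Bundles using (CommutativeSemigroup)
import Algebra.Properties.CommutativeSemigroup as CommSemigroup
open import Data.Bool using (Bool; true; false; _xor_)
open import Data.Bool.Properties using (xor-assoc; xor-comm; xor-identityˡ; xor-identityʳ; xor-same)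
open import Data.Empty using (⊥-elim)
open import Data.List using (List; []; _∷_; [_]; _++_; map; filter; length)
open import Data.List.Membership.Propositional using (_∈_; _∉_; find; lose)
open import Data.List.Membership.Propositional.Properties
  using (∈-++⁺ˡ; ∈-++⁺ʳ; ∈-++⁻; ∈-map⁺; ∈-map⁻; ∈-filter⁺; ∈-filter⁻)
import Data.List.Membership.DecPropositional as DecMembership
open import Data.List.Properties using (map-++; map-∘; map-cong; length-++; length-map)
open import Data.List.Relation.Binary.Permutation.Propositional
  using (_↭_; prep; swap; ↭-sym) renaming (refl to ↭-refl; trans to ↭-trans)
open import Data.List.Relation.Binary.Permutation.Propositional.Properties using (∈-resp-↭; shift; ↭-length)
open import Data.List.Relation.Binary.Subset.Propositional using (_⊆_)
open import Data.List.Relation.Binary.Subset.Propositional.Properties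
  using (⊆-reflexive; ⊆-trans; xs⊆x∷xs; ∷⁺ʳ; ⊆∷∧∉⇒⊆; All-resp-⊇)
import Data.List.Relation.Binary.Subset.DecPropositional as DecSubset
open import Data.List.Relation.Unary.All using (All; []; _∷_)
import Data.List.Relation.Unary.All as All
import Data.List.Relation.Unary.All.Properties as All
open import Data.List.Relation.Unary.All.Properties using (All¬⇒¬Any; ¬Any⇒All¬)
open import Data.List.Relation.Unary.Any using (Any; here; there)
import Data.List.Relation.Unary.Any as Any
import Data.List.Relation.Unary.Any.Properties as Any
open import Data.List.Relation.Unary.Unique.Propositional using (Unique; []; _∷_)
import Data.List.Relation.Unary.Unique.Propositional.Properties as Unique
open import Data.List.Relation.Unary.Unique.Propositional.Properties using (Unique[x∷xs]⇒x∉xs)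
open import Data.Nat using (ℕ; zero; suc; _+_; _*_; _^_; _%_; _≤_; _<_; _≟_; z≤n; s≤s; parity)
open import Data.Nat.Properties
  using (+-assoc; +-comm; +-suc; +-identityʳ; +-mono-≤; +-cancelʳ-≡; +-commutativeSemigroup; *-assoc; *-comm;
         *-identityˡ; *-identityʳ; *-zeroʳ; *-distribˡ-+; *-cancelˡ-≡; *-commutativeSemigroup; ≤-refl; m≤n⇒m≤1+n;
         suc-injective; n<1+n; <⇒≱; <⇒≢; <-cmp; <-irrefl; ^-monoʳ-<; m^n>0; m≢1+n+m; module ≤-Reasoning)
open import Data.Nat.Tactic.RingSolver using (solve-∀)
open import Data.Parity using (Parity; 0ℙ; 1ℙ; _⁻¹) renaming (_+_ to _+ℙ_)
open import Data.Parity.Properties using (+-homo-+; suc-homo-⁻¹; ⁻¹-selfInverse; p+p≡0ℙ)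
  renaming (_≟_ to _≟ℙ_; +-commutativeSemigroup to +ℙ-commutativeSemigroup)
open import Data.Product using (_×_; _,_; proj₁; proj₂; ∃; ∃₂; <_,_>; uncurry)
open import Data.Sum using (inj₁; inj₂)
open import Data.Vec using ([]; _∷_)
open import Data.Vec.Properties using (zipWith-assoc; zipWith-comm; zipWith-identityˡ; zipWith-identityʳ; ∷-injectiveʳ)
open import Function using (_∘_; id)
open import Level using (Level)
open import Relation.Binary.Definitions using (DecidableEquality; tri<; tri≈; tri>)
open import Relation.Binary.PropositionalEquality
  using (_≡_; _≢_; refl; sym; trans; cong; cong₂; subst; module ≡-Reasoning)
open import Relation.Binary.PropositionalEquality.Algebra using (isMagma)
open import Relation.Nullary using (¬_; Dec; yes; no; does)
open import Relation.Nullary.Decidable using (map′; ¬?; _×-dec_; _⊎-dec_; _→-dec_; toWitness)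
open import Relation.Unary using (Pred; Decidable)

private
  variable
    a b p q : Level
    A B : Set a

-- The group ℤ₂ⁿ

module _ {n : ℕ} where

  ⊕-assoc : (u v w : Pt n) → (u ⊕ v) ⊕ w ≡ u ⊕ (v ⊕ w)
  ⊕-assoc = zipWith-assoc xor-assoc

  ⊕-comm : (u v : Pt n) → u ⊕ v ≡ v ⊕ u
  ⊕-comm = zipWith-comm xor-comm

  ⊕-identityˡ : (u : Pt n) → 𝟎 ⊕ u ≡ u
  ⊕-identityˡ = zipWith-identityˡ xor-identityˡ

  ⊕-identityʳ : (u : Pt n) → u ⊕ 𝟎 ≡ u
  ⊕-identityʳ = zipWith-identityʳ xor-identityʳ

  ⊕-commutativeSemigroup : CommutativeSemigroup _ _
  ⊕-commutativeSemigroup = record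
    { _∙_ = _⊕_
    ; isCommutativeSemigroup = record
      { isSemigroup = record { isMagma = isMagma _⊕_ ; assoc = ⊕-assoc }
      ; comm = ⊕-comm
      }
    }

  open CommSemigroup ⊕-commutativeSemigroup public
    using () renaming (interchange to ⊕-interchange; x∙yz≈y∙xz to ⊕-left-comm)

⊕-self : ∀ {n} (u : Pt n) → u ⊕ u ≡ 𝟎
⊕-self [] = refl
⊕-self (a ∷ u) = cong₂ _∷_ (xor-same a) (⊕-self u)

⊕-cancelˡ : ∀ {n} (u v : Pt n) → u ⊕ (u ⊕ v) ≡ v
⊕-cancelˡ u v = begin
  u ⊕ (u ⊕ v)  ≡⟨ ⊕-assoc u u v ⟨
  (u ⊕ u) ⊕ v  ≡⟨ cong (_⊕ v) (⊕-self u) ⟩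
  𝟎 ⊕ v        ≡⟨ ⊕-identityˡ v ⟩
  v            ∎
  where open ≡-Reasoning

⊕-move : ∀ {n} {u v w : Pt n} → u ⊕ v ≡ w → v ≡ u ⊕ w
⊕-move {u = u} {v} refl = sym (⊕-cancelˡ u v)

⊕≡𝟎⇒≡ : ∀ {n} {u v : Pt n} → u ⊕ v ≡ 𝟎 → u ≡ v
⊕≡𝟎⇒≡ {u = u} u⊕v≡𝟎 = sym (trans (⊕-move u⊕v≡𝟎) (⊕-identityʳ u))

infixr 25 _·_

_·_ : ∀ {n} → Bool → Pt n → Pt n
true · v = v
false · v = 𝟎

xor-· : ∀ {n} a b (v : Pt n) → (a xor b) · v ≡ a · v ⊕ b · v
xor-· false b v = sym (⊕-identityˡ (b · v))
xor-· true false v = sym (⊕-identityʳ v)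
xor-· true true v = sym (⊕-self v)

allPts-complete : ∀ {n} (v : Pt n) → v ∈ allPts n
allPts-complete [] = here refl
allPts-complete {suc n} (false ∷ v) = ∈-++⁺ˡ (∈-map⁺ (false ∷_) (allPts-complete v))
allPts-complete {suc n} (true ∷ v) = ∈-++⁺ʳ (map (false ∷_) (allPts n)) (∈-map⁺ (true ∷_) (allPts-complete v))

allPts-unique : ∀ n → Unique (allPts n)
allPts-unique zero = [] ∷ []
allPts-unique (suc n) =
  Unique.++⁺ (Unique.map⁺ ∷-injectiveʳ (allPts-unique n)) (Unique.map⁺ ∷-injectiveʳ (allPts-unique n)) disjoint
  where
    disjoint : ∀ {v} → ¬ (v ∈ map (false ∷_) (allPts n) × v ∈ map (true ∷_) (allPts n))
    disjoint (v∈₀ , v∈₁) with ∈-map⁻ (false ∷_) v∈₀ | ∈-map⁻ (true ∷_) v∈₁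
    ... | _ , _ , refl | _ , _ , ()

length-allPts : ∀ n → length (allPts n) ≡ 2 ^ n
length-allPts zero = refl
length-allPts (suc n) = begin
  length (map (false ∷_) (allPts n) ++ map (true ∷_) (allPts n))
    ≡⟨ length-++ (map (false ∷_) (allPts n)) ⟩
  length (map (false ∷_) (allPts n)) + length (map (true ∷_) (allPts n))
    ≡⟨ cong₂ _+_ (length-map (false ∷_) (allPts n)) (length-map (true ∷_) (allPts n)) ⟩
  length (allPts n) + length (allPts n)
    ≡⟨ cong₂ _+_ (length-allPts n) (trans (length-allPts n) (sym (+-identityʳ (2 ^ n)))) ⟩
  2 ^ n + (2 ^ n + 0)
    ∎
  where open ≡-Reasoning

-- Sums over lists, indicators and double counting

bit : Bool → ℕ
bit false = 0
bit true = 1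

𝟙 : {P : Set p} → Dec P → ℕ
𝟙 P? = bit (does P?)

∑ : List A → (A → ℕ) → ℕ
∑ [] f = 0
∑ (x ∷ xs) f = f x + ∑ xs f

infix 6.5 ∑
syntax ∑ xs (λ x → e) = ∑[ x ∈ xs ] e

𝟙-yes : {P : Set p} (P? : Dec P) → P → 𝟙 P? ≡ 1
𝟙-yes (yes _) _ = refl
𝟙-yes (no ¬p) p = ⊥-elim (¬p p)

𝟙-no : {P : Set p} (P? : Dec P) → ¬ P → 𝟙 P? ≡ 0
𝟙-no (yes p) ¬p = ⊥-elim (¬p p)
𝟙-no (no _) _ = refl

𝟙-guard : {P : Set p} (P? : Dec P) {m n : ℕ} → (P → m ≡ n) → 𝟙 P? * m ≡ 𝟙 P? * n
𝟙-guard (yes p) m≡n = cong (_+ 0) (m≡n p)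
𝟙-guard (no _) _ = refl

𝟙-cong : {P : Set p} {Q : Set q} (P? : Dec P) (Q? : Dec Q) → (P → Q) → (Q → P) → 𝟙 P? ≡ 𝟙 Q?
𝟙-cong (yes _) (yes _) _ _ = refl
𝟙-cong (yes p) (no ¬q) P⇒Q _ = ⊥-elim (¬q (P⇒Q p))
𝟙-cong (no ¬p) (yes q) _ Q⇒P = ⊥-elim (¬p (Q⇒P q))
𝟙-cong (no _) (no _) _ _ = refl

𝟙-mono : {P : Set p} {Q : Set q} (P? : Dec P) (Q? : Dec Q) → (P → Q) → 𝟙 P? ≤ 𝟙 Q?
𝟙-mono (yes _) (yes _) _ = ≤-refl
𝟙-mono (yes p) (no ¬q) P⇒Q = ⊥-elim (¬q (P⇒Q p))
𝟙-mono (no _) _ _ = z≤n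

𝟙-× : {P : Set p} {Q : Set q} (P? : Dec P) (Q? : Dec Q) → 𝟙 (P? ×-dec Q?) ≡ 𝟙 P? * 𝟙 Q?
𝟙-× (yes _) (yes _) = refl
𝟙-× (yes _) (no _) = refl
𝟙-× (no _) _ = refl

𝟙-⇒ : {P : Set p} {Q : Set q} (P? : Dec P) (Q? : Dec Q) → (P → Q) → 𝟙 P? ≡ 𝟙 Q? * 𝟙 P?
𝟙-⇒ (yes p) Q? P⇒Q = sym (cong (_* 1) (𝟙-yes Q? (P⇒Q p)))
𝟙-⇒ (no _) Q? _ = sym (*-zeroʳ (𝟙 Q?))

∑-cong : (xs : List A) {f g : A → ℕ} → (∀ x → x ∈ xs → f x ≡ g x) → ∑ xs f ≡ ∑ xs g
∑-cong [] _ = refl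
∑-cong (x ∷ xs) f≗g = cong₂ _+_ (f≗g x (here refl)) (∑-cong xs λ y y∈xs → f≗g y (there y∈xs))

∑-zero : (xs : List A) {f : A → ℕ} → (∀ x → x ∈ xs → f x ≡ 0) → ∑ xs f ≡ 0
∑-zero [] _ = refl
∑-zero (x ∷ xs) f≗0 = cong₂ _+_ (f≗0 x (here refl)) (∑-zero xs λ y y∈xs → f≗0 y (there y∈xs))

∑-1 : (xs : List A) → ∑[ _ ∈ xs ] 1 ≡ length xs
∑-1 [] = refl
∑-1 (x ∷ xs) = cong suc (∑-1 xs)

∑-++ : (xs ys : List A) (f : A → ℕ) → ∑ (xs ++ ys) f ≡ ∑ xs f + ∑ ys f
∑-++ [] ys f = refl
∑-++ (x ∷ xs) ys f = trans (cong (f x +_) (∑-++ xs ys f)) (sym (+-assoc (f x) (∑ xs f) (∑ ys f)))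

∑-map : (g : A → B) (xs : List A) (f : B → ℕ) → ∑ (map g xs) f ≡ ∑ xs (f ∘ g)
∑-map g [] f = refl
∑-map g (x ∷ xs) f = cong (f (g x) +_) (∑-map g xs f)

∑-+ : (xs : List A) (f g : A → ℕ) → ∑[ x ∈ xs ] (f x + g x) ≡ ∑ xs f + ∑ xs g
∑-+ [] f g = refl
∑-+ (x ∷ xs) f g = trans (cong ((f x + g x) +_) (∑-+ xs f g))
                         (CommSemigroup.interchange +-commutativeSemigroup (f x) (g x) (∑ xs f) (∑ xs g))

∑-*ˡ : (c : ℕ) (xs : List A) (f : A → ℕ) → ∑[ x ∈ xs ] (c * f x) ≡ c * ∑ xs f
∑-*ˡ c [] f = sym (*-zeroʳ c)
∑-*ˡ c (x ∷ xs) f = trans (cong (c * f x +_) (∑-*ˡ c xs f)) (sym (*-distribˡ-+ c (f x) _))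

∑-swap : (xs : List A) (ys : List B) (h : A → B → ℕ) →
         ∑[ x ∈ xs ] ∑[ y ∈ ys ] h x y ≡ ∑[ y ∈ ys ] ∑[ x ∈ xs ] h x y
∑-swap [] ys h = sym (∑-zero ys λ _ _ → refl)
∑-swap (x ∷ xs) ys h =
  trans (cong (∑ ys (h x) +_) (∑-swap xs ys h)) (sym (∑-+ ys (h x) λ y → ∑[ x ∈ xs ] h x y))

∑-mono : (xs : List A) {f g : A → ℕ} → (∀ x → f x ≤ g x) → ∑ xs f ≤ ∑ xs g
∑-mono [] _ = ≤-refl
∑-mono (x ∷ xs) f≤g = +-mono-≤ (f≤g x) (∑-mono xs f≤g)

length-filter-∑ : {P : Pred A p} (P? : Decidable P) (xs : List A) → length (filter P? xs) ≡ ∑[ x ∈ xs ] 𝟙 (P? x)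
length-filter-∑ P? [] = refl
length-filter-∑ P? (x ∷ xs) with does (P? x)
... | true = cong suc (length-filter-∑ P? xs)
... | false = length-filter-∑ P? xs

weighted-count : {P : Pred A p} (P? : Decidable P) (xs : List A) (g : A → ℕ) {c : ℕ} →
                 (∀ x → x ∈ xs → P x → g x ≡ c) → c * length (filter P? xs) ≡ ∑[ x ∈ xs ] 𝟙 (P? x) * g x
weighted-count P? xs g {c} g≡c = begin
  c * length (filter P? xs)     ≡⟨ cong (c *_) (length-filter-∑ P? xs) ⟩
  c * (∑[ x ∈ xs ] 𝟙 (P? x))    ≡⟨ ∑-*ˡ c xs (𝟙 ∘ P?) ⟨
  ∑[ x ∈ xs ] c * 𝟙 (P? x)      ≡⟨ ∑-cong xs (λ x x∈xs → trans (*-comm c _) (𝟙-guard (P? x) λ px → sym (g≡c x x∈xs px)))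
                                 ⟩
  ∑[ x ∈ xs ] 𝟙 (P? x) * g x    ∎
  where open ≡-Reasoning

double-counting : {P : Pred A p} {Q : Pred B q} (P? : Decidable P) (Q? : Decidable Q)
                  (r : A → B → ℕ) (xs : List A) (ys : List B) {c d : ℕ} →
                  (∀ x → x ∈ xs → P x → ∑[ y ∈ ys ] r x y * 𝟙 (Q? y) ≡ c) →
                  (∀ y → y ∈ ys → Q y → ∑[ x ∈ xs ] r x y * 𝟙 (P? x) ≡ d) →
                  c * length (filter P? xs) ≡ d * length (filter Q? ys)
double-counting P? Q? r xs ys {c} {d} row column = begin
  c * length (filter P? xs)                               ≡⟨ weighted-count P? xs _ row ⟩
  ∑[ x ∈ xs ] 𝟙 (P? x) * (∑[ y ∈ ys ] r x y * 𝟙 (Q? y))   ≡⟨ ∑-cong xs (λ x _ → ∑-*ˡ (𝟙 (P? x)) ys _) ⟨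
  ∑[ x ∈ xs ] ∑[ y ∈ ys ] 𝟙 (P? x) * (r x y * 𝟙 (Q? y))   ≡⟨ ∑-swap xs ys _ ⟩
  ∑[ y ∈ ys ] ∑[ x ∈ xs ] 𝟙 (P? x) * (r x y * 𝟙 (Q? y))   ≡⟨ ∑-cong ys (λ y _ → ∑-cong xs λ x _ →
                                                               swap-ends (𝟙 (P? x)) (r x y) (𝟙 (Q? y))) ⟩
  ∑[ y ∈ ys ] ∑[ x ∈ xs ] 𝟙 (Q? y) * (r x y * 𝟙 (P? x))   ≡⟨ ∑-cong ys (λ y _ → ∑-*ˡ (𝟙 (Q? y)) xs _) ⟩
  ∑[ y ∈ ys ] 𝟙 (Q? y) * (∑[ x ∈ xs ] r x y * 𝟙 (P? x))   ≡⟨ weighted-count Q? ys _ column ⟨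
  d * length (filter Q? ys)                               ∎
  where
    open ≡-Reasoning
    swap-ends : ∀ l m n → l * (m * n) ≡ n * (m * l)
    swap-ends = solve-∀

module _ {A : Set a} (_≟_ : DecidableEquality A) where

  ∑-fiber : {ys : List B} (φ : B → A) → Unique ys →
            (∀ {y z} → y ∈ ys → z ∈ ys → φ y ≡ φ z → y ≡ z) →
            ∀ {y} → y ∈ ys → ∑[ z ∈ ys ] 𝟙 (φ z ≟ φ y) ≡ 1
  ∑-fiber {ys = z ∷ zs} φ (z≢zs ∷ zs!) inj (here refl) =
    cong₂ _+_ (𝟙-yes (φ z ≟ φ z) refl)
              (∑-zero zs λ w w∈zs → 𝟙-no (φ w ≟ φ z) λ φw≡φz →
                 All.lookup z≢zs w∈zs (sym (inj (there w∈zs) (here refl) φw≡φz)))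
  ∑-fiber {ys = z ∷ zs} φ (z≢zs ∷ zs!) inj (there y∈zs) =
    cong₂ _+_ (𝟙-no (φ z ≟ φ _) λ φz≡φy → All.lookup z≢zs y∈zs (inj (here refl) (there y∈zs) φz≡φy))
              (∑-fiber φ zs! (λ y∈ z∈ → inj (there y∈) (there z∈)) y∈zs)

  ∑-reindex : {Q : Pred A q} (Q? : Decidable Q) (xs : List A) (ys : List B) (φ : B → A) (g : A → ℕ) →
              (∀ x → ∑[ x′ ∈ xs ] 𝟙 (x′ ≟ x) ≡ 1) →
              (∀ x → Q x → ∑[ y ∈ ys ] 𝟙 (φ y ≟ x) ≡ 1) →
              (∀ y → y ∈ ys → Q (φ y)) →
              ∑[ x ∈ xs ] 𝟙 (Q? x) * g x ≡ ∑[ y ∈ ys ] g (φ y)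
  ∑-reindex Q? xs ys φ g enumerates fiber image = begin
    ∑[ x ∈ xs ] h x                                  ≡⟨ ∑-cong xs (λ x _ → h≡h*fiber x) ⟩
    ∑[ x ∈ xs ] h x * (∑[ y ∈ ys ] 𝟙 (φ y ≟ x))      ≡⟨ ∑-cong xs (λ x _ → ∑-*ˡ (h x) ys _) ⟨
    ∑[ x ∈ xs ] ∑[ y ∈ ys ] h x * 𝟙 (φ y ≟ x)        ≡⟨ ∑-swap xs ys _ ⟩
    ∑[ y ∈ ys ] ∑[ x ∈ xs ] h x * 𝟙 (φ y ≟ x)        ≡⟨ ∑-cong ys (λ y _ → ∑-cong xs λ x _ → concentrate x y) ⟩
    ∑[ y ∈ ys ] ∑[ x ∈ xs ] h (φ y) * 𝟙 (x ≟ φ y)    ≡⟨ ∑-cong ys (λ y _ → ∑-*ˡ (h (φ y)) xs _) ⟩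
    ∑[ y ∈ ys ] h (φ y) * (∑[ x ∈ xs ] 𝟙 (x ≟ φ y))  ≡⟨ ∑-cong ys (λ y y∈ys → cong₂ _*_ (h∘φ y y∈ys) (enumerates (φ y)))
                                                     ⟩
    ∑[ y ∈ ys ] g (φ y) * 1                          ≡⟨ ∑-cong ys (λ y _ → *-identityʳ (g (φ y))) ⟩
    ∑[ y ∈ ys ] g (φ y)                              ∎
    where
      open ≡-Reasoning
      h : A → ℕ
      h x = 𝟙 (Q? x) * g x
      h≡h*fiber : ∀ x → h x ≡ h x * (∑[ y ∈ ys ] 𝟙 (φ y ≟ x))
      h≡h*fiber x = sym (trans (*-assoc (𝟙 (Q? x)) (g x) _)
                               (𝟙-guard (Q? x) λ qx → trans (cong (g x *_) (fiber x qx)) (*-identityʳ (g x))))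
      concentrate : ∀ x y → h x * 𝟙 (φ y ≟ x) ≡ h (φ y) * 𝟙 (x ≟ φ y)
      concentrate x y with φ y ≟ x | x ≟ φ y
      ... | yes refl | yes _ = refl
      ... | yes φy≡x | no x≢φy = ⊥-elim (x≢φy (sym φy≡x))
      ... | no φy≢x | yes x≡φy = ⊥-elim (φy≢x (sym x≡φy))
      ... | no _ | no _ = trans (*-zeroʳ (h x)) (sym (*-zeroʳ (h (φ y))))
      h∘φ : ∀ y → y ∈ ys → h (φ y) ≡ g (φ y)
      h∘φ y y∈ys = trans (cong (_* g (φ y)) (𝟙-yes (Q? (φ y)) (image y y∈ys))) (+-identityʳ (g (φ y)))

-- Subsets chosen from a list

choose-map : (f : A → B) (j : ℕ) (L : List A) → choose j (map f L) ≡ map (map f) (choose j L)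
choose-map f zero L = refl
choose-map f (suc j) [] = refl
choose-map f (suc j) (x ∷ L) = begin
  map (f x ∷_) (choose j (map f L)) ++ choose (suc j) (map f L)
    ≡⟨ cong₂ _++_ (cong (map (f x ∷_)) (choose-map f j L)) (choose-map f (suc j) L) ⟩
  map (f x ∷_) (map (map f) (choose j L)) ++ map (map f) (choose (suc j) L)
    ≡⟨ cong (_++ _) (trans (sym (map-∘ (choose j L))) (map-∘ (choose j L))) ⟩
  map (map f) (map (x ∷_) (choose j L)) ++ map (map f) (choose (suc j) L)
    ≡⟨ map-++ (map f) (map (x ∷_) (choose j L)) _ ⟨
  map (map f) (map (x ∷_) (choose j L) ++ choose (suc j) L)
    ∎
  where open ≡-Reasoning

module _ {A : Set a} where

  data Chosen (y : A) (ys : List A) : ℕ → List A → Set a where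
    skip : ∀ {j S} → S ∈ choose j ys → Chosen y ys j S
    keep : ∀ {j S} → S ∈ choose j ys → Chosen y ys (suc j) (y ∷ S)

  chosen : ∀ j {y : A} {ys S} → S ∈ choose j (y ∷ ys) → Chosen y ys j S
  chosen zero (here refl) = skip (here refl)
  chosen (suc j) {y} {ys} S∈ with ∈-++⁻ (map (y ∷_) (choose j ys)) S∈
  ... | inj₂ S∈ys = skip S∈ys
  ... | inj₁ S∈y∷ys with ∈-map⁻ (y ∷_) S∈y∷ys
  ...   | _ , S′∈ , refl = keep S′∈

  skip⁺ : ∀ j {y : A} {ys S} → S ∈ choose j ys → S ∈ choose j (y ∷ ys)
  skip⁺ zero S∈ = S∈
  skip⁺ (suc j) {y} {ys} S∈ = ∈-++⁺ʳ (map (y ∷_) (choose j ys)) S∈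

  keep⁺ : ∀ j {y : A} {ys S} → S ∈ choose j ys → y ∷ S ∈ choose (suc j) (y ∷ ys)
  keep⁺ j {y} S∈ = ∈-++⁺ˡ (∈-map⁺ (y ∷_) S∈)

  choose-⊆ : ∀ j (L : List A) {S} → S ∈ choose j L → S ⊆ L
  choose-⊆ zero L (here refl) ()
  choose-⊆ (suc j) (y ∷ ys) S∈ with chosen (suc j) S∈
  ... | skip S∈ys = xs⊆x∷xs ys y ∘ choose-⊆ (suc j) ys S∈ys
  ... | keep S′∈ys = ∷⁺ʳ y (choose-⊆ j ys S′∈ys)

  choose-length : ∀ j (L : List A) {S} → S ∈ choose j L → length S ≡ j
  choose-length zero L (here refl) = refl
  choose-length (suc j) (y ∷ ys) S∈ with chosen (suc j) S∈
  ... | skip S∈ys = choose-length (suc j) ys S∈ys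
  ... | keep S′∈ys = cong suc (choose-length j ys S′∈ys)

  choose-unique : ∀ j {L : List A} {S} → Unique L → S ∈ choose j L → Unique S
  choose-unique zero _ (here refl) = []
  choose-unique (suc j) {y ∷ ys} L!@(_ ∷ ys!) S∈ with chosen (suc j) S∈
  ... | skip S∈ys = choose-unique (suc j) ys! S∈ys
  ... | keep {S = S′} S′∈ys =
    ¬Any⇒All¬ S′ (Unique[x∷xs]⇒x∉xs L! ∘ choose-⊆ j ys S′∈ys) ∷ choose-unique j ys! S′∈ys

  choose-[] : ∀ j (K : List A) → length K < j → choose j K ≡ []
  choose-[] (suc j) [] _ = refl
  choose-[] (suc j) (x ∷ K) (s≤s |K|<j) =
    cong₂ _++_ (cong (map (x ∷_)) (choose-[] j K |K|<j)) (choose-[] (suc j) K (m≤n⇒m≤1+n |K|<j))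

  choose-length-self : (K : List A) → choose (length K) K ≡ [ K ]
  choose-length-self [] = refl
  choose-length-self (x ∷ K) =
    cong₂ _++_ (cong (map (x ∷_)) (choose-length-self K)) (choose-[] (suc (length K)) K ≤-refl)

  choose-self : (S : List A) {j : ℕ} → length S ≡ j → choose j S ≡ [ S ]
  choose-self S refl = choose-length-self S

  ∑-choose-∷ : ∀ j (y : A) ys (f : List A → ℕ) →
               ∑ (choose (suc j) (y ∷ ys)) f ≡ ∑ (choose j ys) (f ∘ (y ∷_)) + ∑ (choose (suc j) ys) f
  ∑-choose-∷ j y ys f = trans (∑-++ (map (y ∷_) (choose j ys)) _ f) (cong (_+ _) (∑-map (y ∷_) (choose j ys) f))

  ∑-choose-↭ : ∀ {K K′ : List A} → K ↭ K′ → ∀ j (g : List A → ℕ) → (∀ {T T′} → T ↭ T′ → g T ≡ g T′) →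
               ∑ (choose j K) g ≡ ∑ (choose j K′) g
  ∑-choose-↭ ↭-refl j g g-↭ = refl
  ∑-choose-↭ (↭-trans K↭ ↭K′) j g g-↭ = trans (∑-choose-↭ K↭ j g g-↭) (∑-choose-↭ ↭K′ j g g-↭)
  ∑-choose-↭ (prep x K↭K′) zero g g-↭ = refl
  ∑-choose-↭ {K = x ∷ K} {K′ = x ∷ K′} (prep x K↭K′) (suc j) g g-↭ = begin
    ∑ (choose (suc j) (x ∷ K)) g                            ≡⟨ ∑-choose-∷ j x K g ⟩
    ∑ (choose j K) (g ∘ (x ∷_)) + ∑ (choose (suc j) K) g    ≡⟨ cong₂ _+_ (∑-choose-↭ K↭K′ j (g ∘ (x ∷_)) (g-↭ ∘ prep x))
                                                                         (∑-choose-↭ K↭K′ (suc j) g g-↭) ⟩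
    ∑ (choose j K′) (g ∘ (x ∷_)) + ∑ (choose (suc j) K′) g  ≡⟨ ∑-choose-∷ j x K′ g ⟨
    ∑ (choose (suc j) (x ∷ K′)) g                           ∎
    where open ≡-Reasoning
  ∑-choose-↭ (swap x y K↭K′) zero g g-↭ = refl
  ∑-choose-↭ {K = x ∷ y ∷ K} {K′ = y ∷ x ∷ K′} (swap x y K↭K′) (suc j) g g-↭ = begin
    ∑ (choose (suc j) (x ∷ y ∷ K)) g                              ≡⟨ split x y K ⟩
    (Pair j x y K + ∑ (choose (suc j) K) g)                        ≡⟨ cong₂ _+_ (pair-swap j) (∑-choose-↭ K↭K′ (suc j) g g-↭) ⟩
    (Pair j y x K′ + ∑ (choose (suc j) K′) g)                      ≡⟨ split y x K′ ⟨
    ∑ (choose (suc j) (y ∷ x ∷ K′)) g                             ∎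
    where
      open ≡-Reasoning
      Pair : ℕ → A → A → List A → ℕ
      Pair i a b Z = ∑ (choose i (b ∷ Z)) (g ∘ (a ∷_)) + ∑ (choose i Z) (g ∘ (b ∷_))
      split : ∀ a b Z → ∑ (choose (suc j) (a ∷ b ∷ Z)) g ≡ Pair j a b Z + ∑ (choose (suc j) Z) g
      split a b Z = trans (∑-choose-∷ j a (b ∷ Z) g)
                          (trans (cong (∑ (choose j (b ∷ Z)) (g ∘ (a ∷_)) +_) (∑-choose-∷ j b Z g))
                                 (sym (+-assoc (∑ (choose j (b ∷ Z)) (g ∘ (a ∷_))) _ _)))
      pair-swap : ∀ i → Pair i x y K ≡ Pair i y x K′
      pair-swap zero = +-comm (g (x ∷ []) + 0) (g (y ∷ []) + 0)
      pair-swap (suc i) = begin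
        Pair (suc i) x y K             ≡⟨ cong (_+ By K) (∑-choose-∷ i y K (g ∘ (x ∷_))) ⟩
        (Both x y K + Bx K) + By K     ≡⟨ +-assoc (Both x y K) (Bx K) (By K) ⟩
        Both x y K + (Bx K + By K)     ≡⟨ cong₂ _+_ both-swap (trans (+-comm (Bx K) (By K)) (cong₂ _+_ (B-↭ y) (B-↭ x))) ⟩
        Both y x K′ + (By K′ + Bx K′)  ≡⟨ +-assoc (Both y x K′) (By K′) (Bx K′) ⟨
        (Both y x K′ + By K′) + Bx K′  ≡⟨ cong (_+ Bx K′) (∑-choose-∷ i x K′ (g ∘ (y ∷_))) ⟨
        Pair (suc i) y x K′            ∎
        where
          Both : A → A → List A → ℕ
          Both a b Z = ∑[ T ∈ choose i Z ] g (a ∷ b ∷ T)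
          Bx By : List A → ℕ
          Bx Z = ∑ (choose (suc i) Z) (g ∘ (x ∷_))
          By Z = ∑ (choose (suc i) Z) (g ∘ (y ∷_))
          both-swap : Both x y K ≡ Both y x K′
          both-swap = trans (∑-cong (choose i K) λ T _ → g-↭ (swap x y ↭-refl))
                            (∑-choose-↭ K↭K′ i (λ T → g (y ∷ x ∷ T)) (g-↭ ∘ prep y ∘ prep x))
          B-↭ : ∀ a → ∑ (choose (suc i) K) (g ∘ (a ∷_)) ≡ ∑ (choose (suc i) K′) (g ∘ (a ∷_))
          B-↭ a = ∑-choose-↭ K↭K′ (suc i) (g ∘ (a ∷_)) (g-↭ ∘ prep a)

  module _ (_≟_ : DecidableEquality A) where

    open import Data.List.Membership.DecPropositional _≟_ using (_∉?_)
    open import Data.List.Relation.Binary.Subset.DecPropositional _≟_ using (_⊆?_)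

    choose-⊆-choose : ∀ j i {L S K : List A} → Unique L → S ∈ choose j L → K ∈ choose i L → S ⊆ K → S ∈ choose j K
    choose-⊆-choose zero i _ (here refl) _ _ = here refl
    choose-⊆-choose (suc j) i {y ∷ ys} L!@(_ ∷ ys!) S∈ K∈ S⊆K with chosen (suc j) S∈ | chosen i K∈
    ... | skip S∈ys | skip K∈ys = choose-⊆-choose (suc j) i ys! S∈ys K∈ys S⊆K
    ... | skip S∈ys | keep {j = i′} K′∈ys =
      skip⁺ (suc j) (choose-⊆-choose (suc j) i′ ys! S∈ys K′∈ys (⊆∷∧∉⇒⊆ S⊆K (y∉ys ∘ choose-⊆ (suc j) ys S∈ys)))
      where y∉ys = Unique[x∷xs]⇒x∉xs L!
    ... | keep S′∈ys | skip K∈ys = ⊥-elim (Unique[x∷xs]⇒x∉xs L! (choose-⊆ i ys K∈ys (S⊆K (here refl))))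
    ... | keep S′∈ys | keep {j = i′} K′∈ys =
      keep⁺ j (choose-⊆-choose j i′ ys! S′∈ys K′∈ys
                 (⊆∷∧∉⇒⊆ (S⊆K ∘ there) (Unique[x∷xs]⇒x∉xs L! ∘ choose-⊆ j ys S′∈ys)))

    𝟙-⊆-∷ʳ : ∀ {y S} K → y ∉ S → 𝟙 (S ⊆? y ∷ K) ≡ 𝟙 (S ⊆? K)
    𝟙-⊆-∷ʳ {y} {S} K y∉S =
      𝟙-cong (S ⊆? y ∷ K) (S ⊆? K) (λ S⊆y∷K → ⊆∷∧∉⇒⊆ S⊆y∷K y∉S) (λ S⊆K → xs⊆x∷xs K y ∘ S⊆K)

    𝟙-∷-⊆-∷ : ∀ {y S} K → y ∉ S → 𝟙 (y ∷ S ⊆? y ∷ K) ≡ 𝟙 (S ⊆? K)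
    𝟙-∷-⊆-∷ {y} {S} K y∉S =
      𝟙-cong (y ∷ S ⊆? y ∷ K) (S ⊆? K) (λ y∷S⊆y∷K → ⊆∷∧∉⇒⊆ (y∷S⊆y∷K ∘ there) y∉S) (∷⁺ʳ y)

    ∑-choose-⊆ : ∀ j i {L K : List A} (g : List A → ℕ) → Unique L → K ∈ choose i L →
                 ∑[ S ∈ choose j L ] 𝟙 (S ⊆? K) * g S ≡ ∑ (choose j K) g
    ∑-choose-⊆ zero i {K = K} g _ _ = cong (_+ 0) (trans (cong (_* g []) (𝟙-yes ([] ⊆? K) λ ())) (*-identityˡ (g [])))
    ∑-choose-⊆ (suc j) zero {[]} g _ (here refl) = refl
    ∑-choose-⊆ (suc j) i {y ∷ ys} {K} g L!@(_ ∷ ys!) K∈ with chosen i K∈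
    ... | skip K∈ys = begin
      ∑ (choose (suc j) (y ∷ ys)) F                                ≡⟨ ∑-choose-∷ j y ys F ⟩
      ∑ (choose j ys) (F ∘ (y ∷_)) + ∑ (choose (suc j) ys) F     ≡⟨ cong (_+ ∑ (choose (suc j) ys) F)
                                                                     (∑-zero (choose j ys) λ S _ → cong (_* g (y ∷ S)) (𝟙-no (y ∷ S ⊆? K) y∉K)) ⟩
      ∑ (choose (suc j) ys) F                                     ≡⟨ ∑-choose-⊆ (suc j) i g ys! K∈ys ⟩
      ∑ (choose (suc j) K) g                                      ∎
      where
        open ≡-Reasoning
        F : List A → ℕ
        F S = 𝟙 (S ⊆? K) * g S
        y∉K : ∀ {S} → ¬ (y ∷ S ⊆ K)
        y∉K y∷S⊆K = Unique[x∷xs]⇒x∉xs L! (choose-⊆ i ys K∈ys (y∷S⊆K (here refl)))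
    ... | keep {j = i′} {S = K′} K′∈ys = begin
      ∑ (choose (suc j) (y ∷ ys)) F
        ≡⟨ ∑-choose-∷ j y ys F ⟩
      ∑ (choose j ys) (F ∘ (y ∷_)) + ∑ (choose (suc j) ys) F
        ≡⟨ cong₂ _+_ (∑-cong (choose j ys) λ S S∈ → cong (_* g (y ∷ S)) (𝟙-∷-⊆-∷ K′ (y∉ys ∘ choose-⊆ j ys S∈)))
                     (∑-cong (choose (suc j) ys) λ S S∈ → cong (_* g S) (𝟙-⊆-∷ʳ K′ (y∉ys ∘ choose-⊆ (suc j) ys S∈))) ⟩
      ∑[ S ∈ choose j ys ] 𝟙 (S ⊆? K′) * g (y ∷ S) + ∑[ S ∈ choose (suc j) ys ] 𝟙 (S ⊆? K′) * g S
        ≡⟨ cong₂ _+_ (∑-choose-⊆ j i′ (g ∘ (y ∷_)) ys! K′∈ys) (∑-choose-⊆ (suc j) i′ g ys! K′∈ys) ⟩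
      ∑ (choose j K′) (g ∘ (y ∷_)) + ∑ (choose (suc j) K′) g
        ≡⟨ ∑-choose-∷ j y K′ g ⟨
      ∑ (choose (suc j) (y ∷ K′)) g
        ∎
      where
        open ≡-Reasoning
        F : List A → ℕ
        F S = 𝟙 (S ⊆? y ∷ K′) * g S
        y∉ys = Unique[x∷xs]⇒x∉xs L!

    choose-same-size : ∀ j {L S K : List A} → Unique L → S ∈ choose j L → K ∈ choose j L → S ⊆ K → S ≡ K
    choose-same-size j {L} {S} {K} L! S∈ K∈ S⊆K
      with here S≡K ← subst (S ∈_) (choose-self K (choose-length j L K∈)) (choose-⊆-choose j j L! S∈ K∈ S⊆K) = S≡K

    ∑-choose-⊇ : ∀ j {L S : List A} (f : List A → ℕ) → (∀ {T T′} → T ↭ T′ → f T ≡ f T′) →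
                 Unique L → S ∈ choose j L →
                 ∑[ K ∈ choose (suc j) L ] 𝟙 (S ⊆? K) * f K ≡ ∑[ x ∈ L ] 𝟙 (x ∉? S) * f (x ∷ S)
    ∑-choose-⊇ zero {[]} f f-↭ _ (here refl) = refl
    ∑-choose-⊇ j {y ∷ ys} {S} f f-↭ L!@(_ ∷ ys!) S∈ with chosen j S∈
    ... | skip S∈ys = begin
      ∑ (choose (suc j) (y ∷ ys)) F
        ≡⟨ ∑-choose-∷ j y ys F ⟩
      ∑ (choose j ys) (F ∘ (y ∷_)) + ∑ (choose (suc j) ys) F
        ≡⟨ cong₂ _+_ (∑-cong (choose j ys) λ K K∈ → cong (_* f (y ∷ K)) (only-S K K∈)) (∑-choose-⊇ j f f-↭ ys! S∈ys) ⟩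
      ∑[ K ∈ choose j ys ] 𝟙 (K ⊆? S) * f (y ∷ K) + ∑[ x ∈ ys ] 𝟙 (x ∉? S) * f (x ∷ S)
        ≡⟨ cong (_+ ∑[ x ∈ ys ] 𝟙 (x ∉? S) * f (x ∷ S)) (∑-choose-⊆ j j (f ∘ (y ∷_)) ys! S∈ys) ⟩
      ∑ (choose j S) (f ∘ (y ∷_)) + ∑[ x ∈ ys ] 𝟙 (x ∉? S) * f (x ∷ S)
        ≡⟨ cong (λ T → ∑ T (f ∘ (y ∷_)) + ∑[ x ∈ ys ] 𝟙 (x ∉? S) * f (x ∷ S))
                (choose-self S (choose-length j ys S∈ys)) ⟩
      1 * f (y ∷ S) + ∑[ x ∈ ys ] 𝟙 (x ∉? S) * f (x ∷ S)
        ≡⟨ cong (λ z → z * f (y ∷ S) + ∑[ x ∈ ys ] 𝟙 (x ∉? S) * f (x ∷ S)) (𝟙-yes (y ∉? S) y∉S) ⟨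
      ∑[ x ∈ y ∷ ys ] 𝟙 (x ∉? S) * f (x ∷ S)
        ∎
      where
        open ≡-Reasoning
        F : List A → ℕ
        F K = 𝟙 (S ⊆? K) * f K
        y∉S : y ∉ S
        y∉S = Unique[x∷xs]⇒x∉xs L! ∘ choose-⊆ j ys S∈ys
        only-S : ∀ K → K ∈ choose j ys → 𝟙 (S ⊆? y ∷ K) ≡ 𝟙 (K ⊆? S)
        only-S K K∈ = trans (𝟙-⊆-∷ʳ K y∉S)
          (𝟙-cong (S ⊆? K) (K ⊆? S) (λ S⊆K → ⊆-reflexive (sym (choose-same-size j ys! S∈ys K∈ S⊆K)))
                                    (λ K⊆S → ⊆-reflexive (sym (choose-same-size j ys! K∈ S∈ys K⊆S))))
    ... | keep {j = j′} {S = S′} S′∈ys = begin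
      ∑ (choose (suc (suc j′)) (y ∷ ys)) F
        ≡⟨ ∑-choose-∷ (suc j′) y ys F ⟩
      ∑ (choose (suc j′) ys) (F ∘ (y ∷_)) + ∑ (choose (suc (suc j′)) ys) F
        ≡⟨ cong₂ _+_ (∑-cong (choose (suc j′) ys) λ K _ → cong (_* f (y ∷ K)) (𝟙-∷-⊆-∷ K y∉S′))
                     (∑-zero (choose (suc (suc j′)) ys) λ K K∈ → cong (_* f K) (𝟙-no (y ∷ S′ ⊆? K) λ y∷S′⊆K →
                        y∉ys (choose-⊆ (suc (suc j′)) ys K∈ (y∷S′⊆K (here refl))))) ⟩
      ∑[ K ∈ choose (suc j′) ys ] 𝟙 (S′ ⊆? K) * f (y ∷ K) + 0
        ≡⟨ +-identityʳ _ ⟩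
      ∑[ K ∈ choose (suc j′) ys ] 𝟙 (S′ ⊆? K) * f (y ∷ K)
        ≡⟨ ∑-choose-⊇ j′ (f ∘ (y ∷_)) (f-↭ ∘ prep y) ys! S′∈ys ⟩
      ∑[ x ∈ ys ] 𝟙 (x ∉? S′) * f (y ∷ x ∷ S′)
        ≡⟨ ∑-cong ys (λ x x∈ys → cong₂ _*_ (∉-∷ x x∈ys) (f-↭ (swap y x ↭-refl))) ⟩
      ∑[ x ∈ ys ] 𝟙 (x ∉? y ∷ S′) * f (x ∷ y ∷ S′)
        ≡⟨ cong (λ z → z * f (y ∷ y ∷ S′) + ∑[ x ∈ ys ] 𝟙 (x ∉? y ∷ S′) * f (x ∷ y ∷ S′))
                (𝟙-no (y ∉? y ∷ S′) (λ y∉ → y∉ (here refl))) ⟨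
      ∑[ x ∈ y ∷ ys ] 𝟙 (x ∉? y ∷ S′) * f (x ∷ y ∷ S′)
        ∎
      where
        open ≡-Reasoning
        F : List A → ℕ
        F K = 𝟙 (y ∷ S′ ⊆? K) * f K
        y∉ys : y ∉ ys
        y∉ys = Unique[x∷xs]⇒x∉xs L!
        y∉S′ : y ∉ S′
        y∉S′ = y∉ys ∘ choose-⊆ j′ ys S′∈ys
        ∉-∷ : ∀ x → x ∈ ys → 𝟙 (x ∉? S′) ≡ 𝟙 (x ∉? y ∷ S′)
        ∉-∷ x x∈ys = 𝟙-cong (x ∉? S′) (x ∉? y ∷ S′)
          (λ { x∉S′ (here refl) → y∉ys x∈ys ; x∉S′ (there x∈S′) → x∉S′ x∈S′ })
          (λ x∉y∷S′ → x∉y∷S′ ∘ there)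

    ∑-∉-choose : ∀ j {L S : List A} → Unique L → S ∈ choose j L → ∑[ x ∈ L ] 𝟙 (x ∉? S) + j ≡ length L
    ∑-∉-choose zero {[]} _ (here refl) = refl
    ∑-∉-choose j {y ∷ ys} {S} L!@(_ ∷ ys!) S∈ with chosen j S∈
    ... | skip S∈ys =
      trans (cong (λ z → z + ∑[ x ∈ ys ] 𝟙 (x ∉? S) + j) (𝟙-yes (y ∉? S) (Unique[x∷xs]⇒x∉xs L! ∘ choose-⊆ j ys S∈ys)))
            (cong suc (∑-∉-choose j ys! S∈ys))
    ... | keep {j = j′} {S = S′} S′∈ys = begin
      𝟙 (y ∉? y ∷ S′) + ∑[ x ∈ ys ] 𝟙 (x ∉? y ∷ S′) + suc j′
        ≡⟨ cong (λ z → z + ∑[ x ∈ ys ] 𝟙 (x ∉? y ∷ S′) + suc j′) (𝟙-no (y ∉? y ∷ S′) λ y∉ → y∉ (here refl)) ⟩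
      ∑[ x ∈ ys ] 𝟙 (x ∉? y ∷ S′) + suc j′
        ≡⟨ cong (_+ suc j′) (∑-cong ys ∉-∷) ⟩
      ∑[ x ∈ ys ] 𝟙 (x ∉? S′) + suc j′
        ≡⟨ +-suc _ j′ ⟩
      suc (∑[ x ∈ ys ] 𝟙 (x ∉? S′) + j′)
        ≡⟨ cong suc (∑-∉-choose j′ ys! S′∈ys) ⟩
      suc (length ys)
        ∎
      where
        open ≡-Reasoning
        ∉-∷ : ∀ x → x ∈ ys → 𝟙 (x ∉? y ∷ S′) ≡ 𝟙 (x ∉? S′)
        ∉-∷ x x∈ys = 𝟙-cong (x ∉? y ∷ S′) (x ∉? S′)
          (λ x∉y∷S′ → x∉y∷S′ ∘ there)
          (λ { x∉S′ (here refl) → Unique[x∷xs]⇒x∉xs L! x∈ys ; x∉S′ (there x∈S′) → x∉S′ x∈S′ })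

    ∑-between : ∀ j {L S K : List A} → Unique L → S ∈ choose j L → K ∈ choose (2 + j) L → S ⊆ K →
                ∑[ M ∈ choose (suc j) L ] 𝟙 (M ⊆? K) * 𝟙 (S ⊆? M) ≡ 2
    ∑-between j {L} {S} {K} L! S∈ K∈ S⊆K = +-cancelʳ-≡ j _ 2 (begin
      ∑[ M ∈ choose (suc j) L ] 𝟙 (M ⊆? K) * 𝟙 (S ⊆? M) + j  ≡⟨ cong (_+ j) (∑-choose-⊆ (suc j) (2 + j) (λ M → 𝟙 (S ⊆? M)) L! K∈) ⟩
      ∑[ M ∈ choose (suc j) K ] 𝟙 (S ⊆? M) + j               ≡⟨ cong (_+ j) (∑-cong (choose (suc j) K) λ M _ → sym (*-identityʳ _)) ⟩
      ∑[ M ∈ choose (suc j) K ] 𝟙 (S ⊆? M) * 1 + j           ≡⟨ cong (_+ j) (∑-choose-⊇ j (λ _ → 1) (λ _ → refl) K! S∈K) ⟩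
      ∑[ x ∈ K ] 𝟙 (x ∉? S) * 1 + j                          ≡⟨ cong (_+ j) (∑-cong K λ x _ → *-identityʳ _) ⟩
      ∑[ x ∈ K ] 𝟙 (x ∉? S) + j                              ≡⟨ ∑-∉-choose j K! S∈K ⟩
      length K                                                ≡⟨ choose-length (2 + j) L K∈ ⟩
      2 + j                                                   ∎)
      where
        open ≡-Reasoning
        K! = choose-unique (2 + j) L! K∈
        S∈K = choose-⊆-choose j (2 + j) L! S∈ K∈ S⊆K

    -- Counts the chains S ⊆ M ⊆ K of sizes j, 1 + j, 2 + j in two ways; ∑-between gives two M for each K.
    ∑-supersets-by-two : ∀ j {L S : List A} (f : List A → ℕ) → (∀ {T T′} → T ↭ T′ → f T ≡ f T′) →
                         Unique L → S ∈ choose j L →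
                         2 * (∑[ K ∈ choose (2 + j) L ] 𝟙 (S ⊆? K) * f K)
                           ≡ ∑[ x ∈ L ] 𝟙 (x ∉? S) * (∑[ y ∈ L ] 𝟙 (y ∉? x ∷ S) * f (y ∷ x ∷ S))
    ∑-supersets-by-two j {L} {S} f f-↭ L! S∈ = begin
      2 * (∑[ K ∈ Ks ] 𝟙 (S ⊆? K) * f K)
        ≡⟨ ∑-*ˡ 2 Ks _ ⟨
      ∑[ K ∈ Ks ] 2 * (𝟙 (S ⊆? K) * f K)
        ≡⟨ ∑-cong Ks count-middle ⟩
      ∑[ K ∈ Ks ] (𝟙 (S ⊆? K) * f K) * (∑[ M ∈ Ms ] 𝟙 (M ⊆? K) * 𝟙 (S ⊆? M))
        ≡⟨ ∑-cong Ks (λ K _ → ∑-*ˡ (𝟙 (S ⊆? K) * f K) Ms _) ⟨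
      ∑[ K ∈ Ks ] ∑[ M ∈ Ms ] (𝟙 (S ⊆? K) * f K) * (𝟙 (M ⊆? K) * 𝟙 (S ⊆? M))
        ≡⟨ ∑-swap Ks Ms _ ⟩
      ∑[ M ∈ Ms ] ∑[ K ∈ Ks ] (𝟙 (S ⊆? K) * f K) * (𝟙 (M ⊆? K) * 𝟙 (S ⊆? M))
        ≡⟨ ∑-cong Ms (λ M _ → ∑-cong Ks λ K _ → chain M K) ⟩
      ∑[ M ∈ Ms ] ∑[ K ∈ Ks ] 𝟙 (S ⊆? M) * (𝟙 (M ⊆? K) * f K)
        ≡⟨ ∑-cong Ms (λ M _ → ∑-*ˡ (𝟙 (S ⊆? M)) Ks _) ⟩
      ∑[ M ∈ Ms ] 𝟙 (S ⊆? M) * (∑[ K ∈ Ks ] 𝟙 (M ⊆? K) * f K)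
        ≡⟨ ∑-cong Ms (λ M M∈ → cong (𝟙 (S ⊆? M) *_) (∑-choose-⊇ (suc j) f f-↭ L! M∈)) ⟩
      ∑[ M ∈ Ms ] 𝟙 (S ⊆? M) * g M
        ≡⟨ ∑-choose-⊇ j g g-↭ L! S∈ ⟩
      ∑[ x ∈ L ] 𝟙 (x ∉? S) * g (x ∷ S)
        ∎
      where
        open ≡-Reasoning
        Ks = choose (2 + j) L
        Ms = choose (suc j) L
        g : List A → ℕ
        g M = ∑[ y ∈ L ] 𝟙 (y ∉? M) * f (y ∷ M)
        g-↭ : ∀ {M M′} → M ↭ M′ → g M ≡ g M′
        g-↭ M↭M′ = ∑-cong L λ y _ → cong₂ _*_
          (𝟙-cong (y ∉? _) (y ∉? _) (λ y∉M → y∉M ∘ ∈-resp-↭ (↭-sym M↭M′)) (λ y∉M′ → y∉M′ ∘ ∈-resp-↭ M↭M′))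
          (f-↭ (prep y M↭M′))
        count-middle : ∀ K → K ∈ Ks →
                       2 * (𝟙 (S ⊆? K) * f K) ≡ (𝟙 (S ⊆? K) * f K) * (∑[ M ∈ Ms ] 𝟙 (M ⊆? K) * 𝟙 (S ⊆? M))
        count-middle K K∈ = trans (*-comm 2 (𝟙 (S ⊆? K) * f K)) (trans (*-assoc (𝟙 (S ⊆? K)) (f K) 2)
          (trans (𝟙-guard (S ⊆? K) λ S⊆K → cong (f K *_) (sym (∑-between j L! S∈ K∈ S⊆K)))
                 (sym (*-assoc (𝟙 (S ⊆? K)) (f K) _))))
        chain : ∀ M K → (𝟙 (S ⊆? K) * f K) * (𝟙 (M ⊆? K) * 𝟙 (S ⊆? M)) ≡ 𝟙 (S ⊆? M) * (𝟙 (M ⊆? K) * f K)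
        chain M K with M ⊆? K | S ⊆? M
        ... | yes M⊆K | yes S⊆M rewrite 𝟙-yes (S ⊆? K) (⊆-trans S⊆M M⊆K) =
          trans (*-identityʳ (1 * f K)) (sym (+-identityʳ (1 * f K)))
        ... | yes _ | no _ = *-zeroʳ (𝟙 (S ⊆? K) * f K)
        ... | no _ | yes _ = *-zeroʳ (𝟙 (S ⊆? K) * f K)
        ... | no _ | no _ = *-zeroʳ (𝟙 (S ⊆? K) * f K)

-- Subfamily sums

weight : ∀ {k} → Pt k → ℕ
weight [] = 0
weight (b ∷ w) = bit b + weight w

weight-𝟎 : ∀ k → weight (𝟎 {k}) ≡ 0
weight-𝟎 zero = refl
weight-𝟎 (suc k) = weight-𝟎 k

weight≡0⇒𝟎 : ∀ {k} (w : Pt k) → weight w ≡ 0 → w ≡ 𝟎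
weight≡0⇒𝟎 [] _ = refl
weight≡0⇒𝟎 (false ∷ w) w≡0 = cong (false ∷_) (weight≡0⇒𝟎 w w≡0)

Odd Even : ℕ → Set
Odd k = parity k ≡ 1ℙ
Even k = parity k ≡ 0ℙ

parity-suc : ∀ k → parity (suc k) ≡ parity k ⁻¹
parity-suc k = sym (⁻¹-selfInverse (suc-homo-⁻¹ k))

parity-weight-⊕ : ∀ {k} (u v : Pt k) → parity (weight (u ⊕ v)) ≡ parity (weight u) +ℙ parity (weight v)
parity-weight-⊕ [] [] = refl
parity-weight-⊕ (a ∷ u) (b ∷ v) = begin
  parity (bit (a xor b) + weight (u ⊕ v))                              ≡⟨ +-homo-+ (bit (a xor b)) _ ⟩
  parity (bit (a xor b)) +ℙ parity (weight (u ⊕ v))                    ≡⟨ cong₂ _+ℙ_ (parity-bit-xor a b) (parity-weight-⊕ u v) ⟩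
  (parity (bit a) +ℙ parity (bit b)) +ℙ (parity (weight u) +ℙ parity (weight v))
    ≡⟨ CommSemigroup.interchange +ℙ-commutativeSemigroup (parity (bit a)) _ _ _ ⟩
  (parity (bit a) +ℙ parity (weight u)) +ℙ (parity (bit b) +ℙ parity (weight v))
    ≡⟨ cong₂ _+ℙ_ (+-homo-+ (bit a) (weight u)) (+-homo-+ (bit b) (weight v)) ⟨
  parity (bit a + weight u) +ℙ parity (bit b + weight v)               ∎
  where
    open ≡-Reasoning
    parity-bit-xor : ∀ a b → parity (bit (a xor b)) ≡ parity (bit a) +ℙ parity (bit b)
    parity-bit-xor false b = refl
    parity-bit-xor true false = refl
    parity-bit-xor true true = refl

maskSum : ∀ {n} (C : List (Pt n)) → Pt (length C) → Pt n
maskSum [] [] = 𝟎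
maskSum (c ∷ C) (b ∷ w) = b · c ⊕ maskSum C w

maskSum-𝟎 : ∀ {n} (C : List (Pt n)) → maskSum C 𝟎 ≡ 𝟎
maskSum-𝟎 [] = refl
maskSum-𝟎 (c ∷ C) = trans (⊕-identityˡ (maskSum C 𝟎)) (maskSum-𝟎 C)

maskSum-⊕ : ∀ {n} (C : List (Pt n)) (u v : Pt (length C)) → maskSum C (u ⊕ v) ≡ maskSum C u ⊕ maskSum C v
maskSum-⊕ [] [] [] = sym (⊕-self 𝟎)
maskSum-⊕ (c ∷ C) (a ∷ u) (b ∷ v) = begin
  (a xor b) · c ⊕ maskSum C (u ⊕ v)                ≡⟨ cong₂ _⊕_ (xor-· a b c) (maskSum-⊕ C u v) ⟩
  (a · c ⊕ b · c) ⊕ (maskSum C u ⊕ maskSum C v)    ≡⟨ ⊕-interchange (a · c) (b · c) _ _ ⟩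
  (a · c ⊕ maskSum C u) ⊕ (b · c ⊕ maskSum C v)    ∎
  where open ≡-Reasoning

record SubSum {n} (P : ℕ → Set) (C : List (Pt n)) (v : Pt n) : Set where
  constructor subSum
  field
    mask : Pt (length C)
    mask-size : P (weight mask)
    mask-sum : maskSum C mask ≡ v

module _ {n : ℕ} where

  SubSum-mono : ∀ {P Q : ℕ → Set} {C : List (Pt n)} {v} → (∀ {k} → P k → Q k) → SubSum P C v → SubSum Q C v
  SubSum-mono P⇒Q (subSum w pw sum≡v) = subSum w (P⇒Q pw) sum≡v

  SubSum-∷ : ∀ {P} x {C : List (Pt n)} {v} → SubSum P C v → SubSum P (x ∷ C) v
  SubSum-∷ x (subSum w pw sum≡v) = subSum (false ∷ w) pw (trans (⊕-identityˡ _) sum≡v)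

  private
    mask-↭ : ∀ {C C′ : List (Pt n)} → C ↭ C′ → (w : Pt (length C)) →
             ∃ λ (w′ : Pt (length C′)) → weight w′ ≡ weight w × maskSum C′ w′ ≡ maskSum C w
    mask-↭ ↭-refl w = w , refl , refl
    mask-↭ (prep x C↭C′) (a ∷ w) with mask-↭ C↭C′ w
    ... | w′ , ≡weight , ≡sum = a ∷ w′ , cong (bit a +_) ≡weight , cong (a · x ⊕_) ≡sum
    mask-↭ (swap x y C↭C′) (a ∷ b ∷ w) with mask-↭ C↭C′ w
    ... | w′ , ≡weight , ≡sum =
      b ∷ a ∷ w′ ,
      trans (CommSemigroup.x∙yz≈y∙xz +-commutativeSemigroup (bit b) (bit a) _) (cong (λ z → bit a + (bit b + z)) ≡weight) ,
      trans (⊕-left-comm (b · y) (a · x) _) (cong (λ z → a · x ⊕ (b · y ⊕ z)) ≡sum)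
    mask-↭ (↭-trans C↭C″ C″↭C′) w with mask-↭ C↭C″ w
    ... | w″ , ≡weight , ≡sum with mask-↭ C″↭C′ w″
    ...   | w′ , ≡weight′ , ≡sum′ = w′ , trans ≡weight′ ≡weight , trans ≡sum′ ≡sum

  SubSum-↭ : ∀ {P} {C C′ : List (Pt n)} {v} → C ↭ C′ → SubSum P C v → SubSum P C′ v
  SubSum-↭ {P} C↭C′ (subSum w pw sum≡v) with mask-↭ C↭C′ w
  ... | w′ , ≡weight , ≡sum = subSum w′ (subst P (sym ≡weight) pw) (trans ≡sum sum≡v)

  subSum? : ∀ {P : ℕ → Set} → (∀ k → Dec (P k)) → (C : List (Pt n)) (v : Pt n) → Dec (SubSum P C v)
  subSum? {P} P? C v = map′ from to (Any.any? (λ w → P? (weight w) ×-dec (maskSum C w ≟P v)) (allPts (length C)))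
    where
      Good : Pt (length C) → Set
      Good w = P (weight w) × maskSum C w ≡ v
      from : Any Good (allPts (length C)) → SubSum P C v
      from good with find good
      ... | w , _ , pw , sum≡ = subSum w pw sum≡
      to : SubSum P C v → Any Good (allPts (length C))
      to (subSum w pw sum≡) = lose (allPts-complete w) (pw , sum≡)

  weight≡1⇒∈ : ∀ (C : List (Pt n)) (w : Pt (length C)) → weight w ≡ 1 → maskSum C w ∈ C
  weight≡1⇒∈ [] [] ()
  weight≡1⇒∈ (c ∷ C) (true ∷ w) w≡1 =
    here (trans (cong (λ u → c ⊕ maskSum C u) (weight≡0⇒𝟎 w (suc-injective w≡1)))
                (trans (cong (c ⊕_) (maskSum-𝟎 C)) (⊕-identityʳ c)))
  weight≡1⇒∈ (c ∷ C) (false ∷ w) w≡1 = there (subst (_∈ C) (sym (⊕-identityˡ (maskSum C w))) (weight≡1⇒∈ C w w≡1))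

  Unique⇒¬pair : ∀ {C : List (Pt n)} → Unique C → ¬ SubSum (_≡ 2) C 𝟎
  Unique⇒¬pair {[]} _ (subSum [] () _)
  Unique⇒¬pair {c ∷ C} C! (subSum (true ∷ w) w≡2 sum≡𝟎) =
    Unique[x∷xs]⇒x∉xs C! (subst (_∈ C) (sym (⊕≡𝟎⇒≡ sum≡𝟎)) (weight≡1⇒∈ C w (suc-injective w≡2)))
  Unique⇒¬pair {c ∷ C} (_ ∷ C!) (subSum (false ∷ w) w≡2 sum≡𝟎) =
    Unique⇒¬pair C! (subSum w w≡2 (trans (sym (⊕-identityˡ _)) sum≡𝟎))

-- Affine hulls and affine independence

-- Aff C v says v ∈ aff C; it is the mask counterpart of InAff C v.
Aff : ∀ {n} → List (Pt n) → Pt n → Set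
Aff = SubSum Odd

Cap : ∀ {n} → List (Pt n) → Set
Cap C = ¬ SubSum (_≡ 4) C 𝟎

EvenNonzero : ℕ → Set
EvenNonzero k = Even k × k ≢ 0

-- Affine dependencies over ℤ₂ are the nonempty even subfamilies summing to 𝟎.
Indep : ∀ {n} → List (Pt n) → Set
Indep C = ¬ SubSum EvenNonzero C 𝟎

module _ {n : ℕ} where

  Aff-∈ : ∀ {x} {C : List (Pt n)} → x ∈ C → Aff C x
  Aff-∈ {C = x ∷ C} (here refl) =
    subSum (true ∷ 𝟎) (cong (parity ∘ suc) (weight-𝟎 (length C))) (trans (cong (x ⊕_) (maskSum-𝟎 C)) (⊕-identityʳ x))
  Aff-∈ {C = c ∷ C} (there x∈C) = SubSum-∷ c (Aff-∈ x∈C)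

  -- Deciding Aff through this list, rather than by enumerating masks, keeps the computations below fast.
  sums : Parity → List (Pt n) → List (Pt n)
  sums p (c ∷ C) = sums p C ++ map (c ⊕_) (sums (p ⁻¹) C)
  sums 0ℙ [] = [ 𝟎 ]
  sums 1ℙ [] = []

  ∈-sums⁺ : ∀ p (C : List (Pt n)) {v} → SubSum (λ k → parity k ≡ p) C v → v ∈ sums p C
  ∈-sums⁺ 0ℙ [] (subSum [] _ refl) = here refl
  ∈-sums⁺ 1ℙ [] (subSum [] () _)
  ∈-sums⁺ p (c ∷ C) (subSum (false ∷ w) pw refl) =
    ∈-++⁺ˡ (subst (_∈ sums p C) (sym (⊕-identityˡ _)) (∈-sums⁺ p C (subSum w pw refl)))
  ∈-sums⁺ p (c ∷ C) (subSum (true ∷ w) pw refl) =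
    ∈-++⁺ʳ (sums p C) (∈-map⁺ (c ⊕_) (∈-sums⁺ (p ⁻¹) C (subSum w pw′ refl)))
    where pw′ = sym (⁻¹-selfInverse (trans (sym (parity-suc (weight w))) pw))

  ∈-sums⁻ : ∀ p (C : List (Pt n)) {v} → v ∈ sums p C → SubSum (λ k → parity k ≡ p) C v
  ∈-sums⁻ 0ℙ [] (here refl) = subSum [] refl refl
  ∈-sums⁻ p (c ∷ C) v∈ with ∈-++⁻ (sums p C) v∈
  ... | inj₁ v∈sums = SubSum-∷ c (∈-sums⁻ p C v∈sums)
  ... | inj₂ v∈c⊕sums with ∈-map⁻ (c ⊕_) v∈c⊕sums
  ...   | u , u∈ , refl with ∈-sums⁻ (p ⁻¹) C u∈
  ...     | subSum w pw refl = subSum (true ∷ w) (trans (parity-suc (weight w)) (⁻¹-selfInverse (sym pw))) refl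

  aff? : (C : List (Pt n)) (v : Pt n) → Dec (Aff C v)
  aff? C v = map′ (∈-sums⁻ 1ℙ C) (∈-sums⁺ 1ℙ C) (v ∈? sums 1ℙ C)
    where open import Data.List.Membership.DecPropositional _≟P_ using (_∈?_)

  Indep-[] : Indep {n} []
  Indep-[] (subSum [] (_ , 0≢0) _) = 0≢0 refl

  Indep-∷ : ∀ {x} {C : List (Pt n)} → Indep C → ¬ Aff C x → Indep (x ∷ C)
  Indep-∷ C! x∉ (subSum (false ∷ w) pw sum≡𝟎) = C! (subSum w pw (trans (sym (⊕-identityˡ _)) sum≡𝟎))
  Indep-∷ C! x∉ (subSum (true ∷ w) (even , _) sum≡𝟎) =
    x∉ (subSum w (sym (⁻¹-selfInverse (trans (sym (parity-suc (weight w))) even))) (sym (⊕≡𝟎⇒≡ sum≡𝟎)))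

  Indep-tail : ∀ {x} {C : List (Pt n)} → Indep (x ∷ C) → Indep C
  Indep-tail x∷C! = x∷C! ∘ SubSum-∷ _

  Indep-head : ∀ {x} {C : List (Pt n)} → Indep (x ∷ C) → ¬ Aff C x
  Indep-head x∷C! (subSum w odd refl) =
    x∷C! (subSum (true ∷ w) (trans (parity-suc (weight w)) (cong _⁻¹ odd) , λ ()) (⊕-self _))

  indep? : (C : List (Pt n)) → Dec (Indep C)
  indep? [] = yes Indep-[]
  indep? (x ∷ C) = map′ (uncurry Indep-∷) < Indep-tail , Indep-head > (indep? C ×-dec ¬? (aff? C x))

  Indep⇒injective : ∀ {C : List (Pt n)} → Indep C → ∀ u v →
                    parity (weight u) ≡ parity (weight v) → maskSum C u ≡ maskSum C v → u ≡ v
  Indep⇒injective {C} C! u v same-parity same-sum with weight (u ⊕ v) ≟ 0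
  ... | yes weight≡0 = ⊕≡𝟎⇒≡ (weight≡0⇒𝟎 (u ⊕ v) weight≡0)
  ... | no weight≢0 = ⊥-elim (C! (subSum (u ⊕ v) (even , weight≢0) sum≡𝟎))
    where
      even : Even (weight (u ⊕ v))
      even = trans (parity-weight-⊕ u v) (trans (cong (_+ℙ parity (weight v)) same-parity) (p+p≡0ℙ (parity (weight v))))
      sum≡𝟎 : maskSum C (u ⊕ v) ≡ 𝟎
      sum≡𝟎 = trans (maskSum-⊕ C u v) (trans (cong (_⊕ maskSum C v) same-sum) (⊕-self _))

  Indep⇒Cap : ∀ {C : List (Pt n)} → Indep C → Cap C
  Indep⇒Cap C! = C! ∘ SubSum-mono λ { refl → refl , λ () }

  infix 4 _⊑_
  _⊑_ : List (Pt n) → List (Pt n) → Set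
  C ⊑ D = ∀ {v} → Aff C v → Aff D v

  ⊆Aff⇒⊑ : ∀ {C D : List (Pt n)} → (∀ {c} → c ∈ C → Aff D c) → C ⊑ D
  ⊆Aff⇒⊑ {C} {D} C⊆aff[D] (subSum w odd refl) with resum C C⊆aff[D] w
    where
      resum : ∀ C → (∀ {c} → c ∈ C → Aff D c) → (w : Pt (length C)) →
              ∃ λ W → parity (weight W) ≡ parity (weight w) × maskSum D W ≡ maskSum C w
      resum [] _ [] = 𝟎 , cong parity (weight-𝟎 (length D)) , maskSum-𝟎 D
      resum (c ∷ C) C⊆ (false ∷ w) with resum C (C⊆ ∘ there) w
      ... | W , ≡parity , ≡sum = W , ≡parity , trans ≡sum (sym (⊕-identityˡ _))
      resum (c ∷ C) C⊆ (true ∷ w) with resum C (C⊆ ∘ there) w | C⊆ (here refl)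
      ... | W , ≡parity , ≡sum | subSum Wc odd refl =
        Wc ⊕ W ,
        trans (parity-weight-⊕ Wc W) (trans (cong₂ _+ℙ_ odd ≡parity) (sym (parity-suc (weight w)))) ,
        trans (maskSum-⊕ D Wc W) (cong (maskSum D Wc ⊕_) ≡sum)
  ... | W , ≡parity , ≡sum = subSum W (trans ≡parity odd) ≡sum

  ⊑-∷ : ∀ {c} {C : List (Pt n)} → Aff C c → c ∷ C ⊑ C
  ⊑-∷ c∈aff[C] = ⊆Aff⇒⊑ λ { (here refl) → c∈aff[C] ; (there x∈C) → Aff-∈ x∈C }

allPts-enumerates : ∀ {n} (v : Pt n) → ∑[ u ∈ allPts n ] 𝟙 (u ≟P v) ≡ 1
allPts-enumerates v = ∑-fiber _≟P_ id (allPts-unique _) (λ _ _ u≡v → u≡v) (allPts-complete v)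

odd? : ∀ {k} (w : Pt k) → Dec (Odd (weight w))
odd? w = parity (weight w) ≟ℙ 1ℙ

oddMasks : ∀ k → List (Pt k)
oddMasks k = filter odd? (allPts k)

length-oddMasks : ∀ ℓ → length (oddMasks (suc ℓ)) ≡ 2 ^ ℓ
length-oddMasks ℓ = begin
  length (oddMasks (suc ℓ))                                       ≡⟨ length-filter-∑ odd? (allPts (suc ℓ)) ⟩
  ∑[ w ∈ map (false ∷_) (allPts ℓ) ++ map (true ∷_) (allPts ℓ) ] 𝟙 (odd? w)
    ≡⟨ ∑-++ (map (false ∷_) (allPts ℓ)) _ (𝟙 ∘ odd?) ⟩
  ∑[ w ∈ map (false ∷_) (allPts ℓ) ] 𝟙 (odd? w) + ∑[ w ∈ map (true ∷_) (allPts ℓ) ] 𝟙 (odd? w)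
    ≡⟨ cong₂ _+_ (∑-map (false ∷_) (allPts ℓ) (𝟙 ∘ odd?)) (∑-map (true ∷_) (allPts ℓ) (𝟙 ∘ odd?)) ⟩
  ∑[ w ∈ allPts ℓ ] 𝟙 (odd? w) + ∑[ w ∈ allPts ℓ ] 𝟙 (odd? (true ∷ w))
    ≡⟨ ∑-+ (allPts ℓ) _ _ ⟨
  ∑[ w ∈ allPts ℓ ] (𝟙 (odd? w) + 𝟙 (odd? (true ∷ w)))           ≡⟨ ∑-cong (allPts ℓ) (λ w _ → one-of-two (weight w)) ⟩
  ∑[ w ∈ allPts ℓ ] 1                                             ≡⟨ ∑-1 (allPts ℓ) ⟩
  length (allPts ℓ)                                               ≡⟨ length-allPts ℓ ⟩
  2 ^ ℓ                                                           ∎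
  where
    open ≡-Reasoning
    one-of-two : ∀ k → 𝟙 (parity k ≟ℙ 1ℙ) + 𝟙 (parity (suc k) ≟ℙ 1ℙ) ≡ 1
    one-of-two k rewrite parity-suc k with parity k
    ... | 0ℙ = refl
    ... | 1ℙ = refl

2^-injective : ∀ {m n} → 2 ^ m ≡ 2 ^ n → m ≡ n
2^-injective {m} {n} 2^m≡2^n with <-cmp m n
... | tri< m<n _ _ = ⊥-elim (<-irrefl 2^m≡2^n (^-monoʳ-< 2 (s≤s (s≤s z≤n)) m<n))
... | tri≈ _ m≡n _ = m≡n
... | tri> _ _ n<m = ⊥-elim (<-irrefl (sym 2^m≡2^n) (^-monoʳ-< 2 (s≤s (s≤s z≤n)) n<m))

∈-oddMasks : ∀ {k} {w : Pt k} → Odd (weight w) → w ∈ oddMasks k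
∈-oddMasks {w = w} odd = ∈-filter⁺ odd? (allPts-complete w) odd

module _ {n : ℕ} where

  affSize : List (Pt n) → ℕ
  affSize C = ∑[ v ∈ allPts n ] 𝟙 (aff? C v)

  ∑-aff : ∀ {C : List (Pt n)} → Indep C → (g : Pt n → ℕ) →
          ∑[ v ∈ allPts n ] 𝟙 (aff? C v) * g v ≡ ∑[ w ∈ oddMasks (length C) ] g (maskSum C w)
  ∑-aff {C} C! g = ∑-reindex _≟P_ (aff? C) (allPts n) (oddMasks (length C)) (maskSum C) g allPts-enumerates fiber image
    where
      odd-mask : ∀ {w} → w ∈ oddMasks (length C) → Odd (weight w)
      odd-mask w∈ = proj₂ (∈-filter⁻ odd? {xs = allPts (length C)} w∈)
      fiber : ∀ x → Aff C x → ∑[ w ∈ oddMasks (length C) ] 𝟙 (maskSum C w ≟P x) ≡ 1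
      fiber x (subSum w odd refl) =
        ∑-fiber _≟P_ (maskSum C) (Unique.filter⁺ odd? (allPts-unique _))
                (λ u∈ v∈ → Indep⇒injective C! _ _ (trans (odd-mask u∈) (sym (odd-mask v∈))))
                (∈-filter⁺ odd? (allPts-complete w) odd)
      image : ∀ w → w ∈ oddMasks (length C) → Aff C (maskSum C w)
      image w w∈ = subSum w (odd-mask w∈) refl

  affSize-indep : ∀ {C : List (Pt n)} {ℓ} → Indep C → length C ≡ suc ℓ → affSize C ≡ 2 ^ ℓ
  affSize-indep {C} {ℓ} C! |C|≡ = begin
    ∑[ v ∈ allPts n ] 𝟙 (aff? C v)              ≡⟨ ∑-cong (allPts n) (λ v _ → *-identityʳ _) ⟨
    ∑[ v ∈ allPts n ] 𝟙 (aff? C v) * 1          ≡⟨ ∑-aff C! (λ _ → 1) ⟩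
    ∑[ _ ∈ oddMasks (length C) ] 1               ≡⟨ ∑-1 (oddMasks (length C)) ⟩
    length (oddMasks (length C))                 ≡⟨ cong (length ∘ oddMasks) |C|≡ ⟩
    length (oddMasks (suc ℓ))                    ≡⟨ length-oddMasks ℓ ⟩
    2 ^ ℓ                                        ∎
    where open ≡-Reasoning

  affSize-mono : ∀ {C D : List (Pt n)} → C ⊑ D → affSize C ≤ affSize D
  affSize-mono {C} {D} C⊑D = ∑-mono (allPts n) λ v → 𝟙-mono (aff? C v) (aff? D v) C⊑D

  affSize-cong : ∀ {C D : List (Pt n)} → C ⊑ D → D ⊑ C → affSize C ≡ affSize D
  affSize-cong {C} {D} C⊑D D⊑C = ∑-cong (allPts n) λ v _ → 𝟙-cong (aff? C v) (aff? D v) C⊑D D⊑C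

  affSize-[] : affSize [] ≡ 0
  affSize-[] = ∑-zero (allPts n) λ v _ → 𝟙-no (aff? [] v) λ { (subSum [] () _) }

  record Basis (C : List (Pt n)) : Set where
    constructor basis
    field
      rest elements : List (Pt n)
      split : C ↭ rest ++ elements
      independent : Indep elements
      spans : C ⊑ elements
      spanned : elements ⊑ C

  basis-of : (C : List (Pt n)) → Basis C
  basis-of [] = basis [] [] ↭-refl Indep-[] id id
  basis-of (x ∷ C) with basis-of C
  ... | basis R B C↭R++B B! C⊑B B⊑C with aff? B x
  ...   | yes x∈aff[B] = basis (x ∷ R) B (prep x C↭R++B) B! (C⊑B ∘ ⊑-∷ (B⊑C x∈aff[B])) (SubSum-∷ x ∘ B⊑C)
  ...   | no x∉aff[B] = basis R (x ∷ B) (↭-trans (prep x C↭R++B) (↭-sym (shift x R B))) (Indep-∷ B! x∉aff[B])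
                              (⊆Aff⇒⊑ λ { (here refl) → Aff-∈ (here refl) ; (there c∈C) → SubSum-∷ x (C⊑B (Aff-∈ c∈C)) })
                              (⊆Aff⇒⊑ λ { (here refl) → Aff-∈ (here refl) ; (there b∈B) → SubSum-∷ x (B⊑C (Aff-∈ b∈B)) })

  basis-length : ∀ {C : List (Pt n)} {r} (b : Basis C) → affSize C ≡ 2 ^ r → length (Basis.elements b) ≡ suc r
  basis-length {r = r} (basis R [] _ _ C⊑B B⊑C) size≡ =
    ⊥-elim (<⇒≢ (m^n>0 2 r) (trans (sym (trans (affSize-cong C⊑B B⊑C) affSize-[])) size≡))
  basis-length (basis R (b ∷ B) _ B! C⊑B B⊑C) size≡ =
    cong suc (2^-injective (trans (sym (affSize-indep B! refl)) (trans (sym (affSize-cong C⊑B B⊑C)) size≡)))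

  Indep-↭ : ∀ {C C′ : List (Pt n)} → C ↭ C′ → Indep C → Indep C′
  Indep-↭ C↭C′ C! = C! ∘ SubSum-↭ (↭-sym C↭C′)

  Indep-of-dim : ∀ {T : List (Pt n)} {r} → length T ≡ suc r → affSize T ≡ 2 ^ r → Indep T
  Indep-of-dim {T} {r} |T|≡ size≡ with basis-of T | basis-length (basis-of T) size≡
  ... | basis [] B T↭B B! _ _ | _ = Indep-↭ (↭-sym T↭B) B!
  ... | basis (x ∷ R) B T↭R++B _ _ _ | |B|≡ = ⊥-elim (m≢1+n+m (suc r) (begin
    suc r                      ≡⟨ |T|≡ ⟨
    length T                   ≡⟨ ↭-length T↭R++B ⟩
    suc (length (R ++ B))      ≡⟨ cong suc (length-++ R) ⟩
    suc (length R + length B)  ≡⟨ cong (λ l → suc (length R + l)) |B|≡ ⟩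
    suc (length R + suc r)     ∎))
    where open ≡-Reasoning

  aff-maximal : ∀ {S T : List (Pt n)} {x r} → Indep S → length S ≡ suc r → affSize T ≡ 2 ^ r → x ∷ S ⊑ T → Aff S x
  aff-maximal {S} {T} {x} {r} S! |S|≡ size≡ x∷S⊑T with aff? S x
  ... | yes x∈aff[S] = x∈aff[S]
  ... | no x∉aff[S] = ⊥-elim (<⇒≱ (^-monoʳ-< 2 (s≤s (s≤s z≤n)) (n<1+n r)) (begin
    2 ^ suc r         ≡⟨ affSize-indep (Indep-∷ S! x∉aff[S]) (cong suc |S|≡) ⟨
    affSize (x ∷ S)  ≤⟨ affSize-mono x∷S⊑T ⟩
    affSize T        ≡⟨ size≡ ⟩
    2 ^ r             ∎))
    where open ≤-Reasoning

-- Caps and dimension as defined in Defs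

module _ {n : ℕ} where

  sublists⇒SubSum : ∀ {P} (C : List (Pt n)) {v} → Any (λ s → P (length s) × sumL s ≡ v) (sublists C) → SubSum P C v
  sublists⇒SubSum [] (here (pk , refl)) = subSum [] pk refl
  sublists⇒SubSum {P} (c ∷ C) {v} s∈ with Any.++⁻ (map (c ∷_) (sublists C)) s∈
  ... | inj₂ s∈C = SubSum-∷ c (sublists⇒SubSum C s∈C)
  ... | inj₁ s∈c∷C with sublists⇒SubSum {P ∘ suc} C (Any.map (λ (pk , sum≡) → pk , ⊕-move sum≡) (Any.map⁻ s∈c∷C))
  ...   | subSum w pw sum≡ = subSum (true ∷ w) pw (trans (cong (c ⊕_) sum≡) (⊕-cancelˡ c v))

  SubSum⇒sublists : ∀ {P} (C : List (Pt n)) {v} → SubSum P C v → Any (λ s → P (length s) × sumL s ≡ v) (sublists C)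
  SubSum⇒sublists [] (subSum [] pk refl) = here (pk , refl)
  SubSum⇒sublists {P} (c ∷ C) (subSum (false ∷ w) pw sum≡) =
    Any.++⁺ʳ (map (c ∷_) (sublists C)) (SubSum⇒sublists {P} C (subSum w pw (trans (sym (⊕-identityˡ _)) sum≡)))
  SubSum⇒sublists {P} (c ∷ C) (subSum (true ∷ w) pw refl) =
    Any.++⁺ˡ (Any.map⁺ (Any.map (λ (pk , sum≡) → pk , cong (c ⊕_) sum≡) (SubSum⇒sublists {P ∘ suc} C (subSum w pw refl))))

  choose⇒SubSum : ∀ k (C : List (Pt n)) {v} → Any (λ s → sumL s ≡ v) (choose k C) → SubSum (_≡ k) C v
  choose⇒SubSum zero C (here sum≡) = subSum 𝟎 (weight-𝟎 (length C)) (trans (maskSum-𝟎 C) sum≡)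
  choose⇒SubSum (suc k) (c ∷ C) {v} s∈ with Any.++⁻ (map (c ∷_) (choose k C)) s∈
  ... | inj₂ s∈C = SubSum-∷ c (choose⇒SubSum (suc k) C s∈C)
  ... | inj₁ s∈c∷C with choose⇒SubSum k C (Any.map ⊕-move (Any.map⁻ s∈c∷C))
  ...   | subSum w w≡k sum≡ = subSum (true ∷ w) (cong suc w≡k) (trans (cong (c ⊕_) sum≡) (⊕-cancelˡ c v))

  SubSum⇒choose : ∀ k (C : List (Pt n)) {v} → SubSum (_≡ k) C v → Any (λ s → sumL s ≡ v) (choose k C)
  SubSum⇒choose zero C (subSum w w≡0 refl) = here (sym (trans (cong (maskSum C) (weight≡0⇒𝟎 w w≡0)) (maskSum-𝟎 C)))
  SubSum⇒choose (suc k) [] (subSum [] () _)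
  SubSum⇒choose (suc k) (c ∷ C) (subSum (false ∷ w) w≡k sum≡) =
    Any.++⁺ʳ (map (c ∷_) (choose k C)) (SubSum⇒choose (suc k) C (subSum w w≡k (trans (sym (⊕-identityˡ _)) sum≡)))
  SubSum⇒choose (suc k) (c ∷ C) (subSum (true ∷ w) w≡k refl) =
    Any.++⁺ˡ (Any.map⁺ (Any.map (cong (c ⊕_)) (SubSum⇒choose k C (subSum w (suc-injective w≡k) refl))))

  IsCap⇒Cap : (C : List (Pt n)) → IsCap C → Cap C
  IsCap⇒Cap C isCap = All¬⇒¬Any isCap ∘ SubSum⇒choose 4 C

  Cap⇒IsCap : (C : List (Pt n)) → Cap C → IsCap C
  Cap⇒IsCap C cap = ¬Any⇒All¬ (choose 4 C) (cap ∘ choose⇒SubSum 4 C)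

  Odd⇒%2≡1 : ∀ k → Odd k → k % 2 ≡ 1
  Odd⇒%2≡1 1 _ = refl
  Odd⇒%2≡1 (suc (suc k)) odd = Odd⇒%2≡1 k odd

  %2≡1⇒Odd : ∀ k → k % 2 ≡ 1 → Odd k
  %2≡1⇒Odd 1 _ = refl
  %2≡1⇒Odd (suc (suc k)) k%2≡1 = %2≡1⇒Odd k k%2≡1

  length-aff : (C : List (Pt n)) → length (aff C) ≡ affSize C
  length-aff C = trans (length-filter-∑ (inAff? C) (allPts n)) (∑-cong (allPts n) λ v _ →
    𝟙-cong (inAff? C v) (aff? C v) (SubSum-mono (λ {k} → %2≡1⇒Odd k) ∘ sublists⇒SubSum C)
                                   (SubSum⇒sublists C ∘ SubSum-mono (λ {k} → Odd⇒%2≡1 k)))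

CapDim : ∀ {n} → ℕ → List (Pt n) → Set
CapDim r C = IsCap C × HasDim r C

capDim? : ∀ {n} (r : ℕ) (C : List (Pt n)) → Dec (CapDim r C)
capDim? r C = isCap? C ×-dec hasDim? r C

module _ {n : ℕ} where

  CapDim-↭ : ∀ r {C C′ : List (Pt n)} → C ↭ C′ → CapDim r C → CapDim r C′
  CapDim-↭ r {C} {C′} C↭C′ (isCap , dim) =
    Cap⇒IsCap C′ (IsCap⇒Cap C isCap ∘ SubSum-↭ (↭-sym C↭C′)) ,
    trans (length-aff C′) (trans (affSize-cong (SubSum-↭ (↭-sym C↭C′)) (SubSum-↭ C↭C′)) (trans (sym (length-aff C)) dim))

  𝟙-capDim-↭ : ∀ r {C C′ : List (Pt n)} → C ↭ C′ → 𝟙 (capDim? r C) ≡ 𝟙 (capDim? r C′)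
  𝟙-capDim-↭ r {C} {C′} C↭C′ = 𝟙-cong (capDim? r C) (capDim? r C′) (CapDim-↭ r C↭C′) (CapDim-↭ r (↭-sym C↭C′))

  CapDim⇒Indep : ∀ r (T : List (Pt n)) → length T ≡ suc r → CapDim r T → Indep T
  CapDim⇒Indep r T |T|≡ (_ , dim) = Indep-of-dim |T|≡ (trans (sym (length-aff T)) dim)

  Indep⇒CapDim : ∀ r (T : List (Pt n)) → length T ≡ suc r → Indep T → CapDim r T
  Indep⇒CapDim r T |T|≡ T! = Cap⇒IsCap T (Indep⇒Cap T!) , trans (length-aff T) (affSize-indep T! |T|≡)

  CapDim-extension : ∀ {S : List (Pt n)} {x y r} → Indep S → length S ≡ suc r → Aff S x → Aff S y →
                     Cap (y ∷ x ∷ S) → CapDim r (y ∷ x ∷ S)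
  CapDim-extension {S} {x} {y} S! |S|≡ x∈aff[S] y∈aff[S] cap =
    Cap⇒IsCap (y ∷ x ∷ S) cap ,
    trans (length-aff (y ∷ x ∷ S)) (trans (affSize-cong y∷x∷S⊑S (SubSum-∷ y ∘ SubSum-∷ x)) (affSize-indep S! |S|≡))
    where
      y∷x∷S⊑S : y ∷ x ∷ S ⊑ S
      y∷x∷S⊑S = ⊆Aff⇒⊑ λ { (here refl) → y∈aff[S] ; (there (here refl)) → x∈aff[S] ; (there (there s∈S)) → Aff-∈ s∈S }

-- Coordinates with respect to an affine basis

infix 4 _∉?_ _⊆?_

_∉?_ : ∀ {n} (x : Pt n) (xs : List (Pt n)) → Dec (x ∉ xs)
_∉?_ = DecMembership._∉?_ _≟P_

_⊆?_ : ∀ {n} (xs ys : List (Pt n)) → Dec (xs ⊆ ys)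
_⊆?_ = DecSubset._⊆?_ _≟P_

units : ∀ k → List (Pt k)
units zero = []
units (suc k) = (true ∷ 𝟎) ∷ map (false ∷_) (units k)

units-odd : ∀ k → All (Odd ∘ weight) (units k)
units-odd zero = []
units-odd (suc k) = cong (parity ∘ suc) (weight-𝟎 k) ∷ All.map⁺ (units-odd k)

map-units : ∀ {n} (S : List (Pt n)) → map (maskSum S) (units (length S)) ≡ S
map-units [] = refl
map-units (x ∷ S) = cong₂ _∷_ (trans (cong (x ⊕_) (maskSum-𝟎 S)) (⊕-identityʳ x))
  (trans (sym (map-∘ (units (length S)))) (trans (map-cong (λ w → ⊕-identityˡ (maskSum S w)) (units (length S))) (map-units S)))

module Coordinates {n} (S : List (Pt n)) where

  φ : Pt (length S) → Pt n
  φ = maskSum S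

  φ-· : ∀ a (d : Pt (length S)) → φ (a · d) ≡ a · φ d
  φ-· true d = refl
  φ-· false d = maskSum-𝟎 S

  private
    mask-map⁺ : ∀ (D : List (Pt (length S))) (w : Pt (length D)) →
                ∃ λ (w′ : Pt (length (map φ D))) → weight w′ ≡ weight w × maskSum (map φ D) w′ ≡ φ (maskSum D w)
    mask-map⁺ [] [] = [] , refl , sym (maskSum-𝟎 S)
    mask-map⁺ (d ∷ D) (a ∷ w) with mask-map⁺ D w
    ... | w′ , ≡weight , ≡sum =
      a ∷ w′ , cong (bit a +_) ≡weight , trans (cong₂ _⊕_ (sym (φ-· a d)) ≡sum) (sym (maskSum-⊕ S (a · d) (maskSum D w)))

    mask-map⁻ : ∀ (D : List (Pt (length S))) (w′ : Pt (length (map φ D))) →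
                ∃ λ (w : Pt (length D)) → weight w ≡ weight w′ × φ (maskSum D w) ≡ maskSum (map φ D) w′
    mask-map⁻ [] [] = [] , refl , maskSum-𝟎 S
    mask-map⁻ (d ∷ D) (a ∷ w′) with mask-map⁻ D w′
    ... | w , ≡weight , ≡sum =
      a ∷ w , cong (bit a +_) ≡weight , trans (maskSum-⊕ S (a · d) (maskSum D w)) (cong₂ _⊕_ (φ-· a d) ≡sum)

  SubSum-map⁺ : ∀ {P} (D : List (Pt (length S))) {u} → SubSum P D u → SubSum P (map φ D) (φ u)
  SubSum-map⁺ {P} D (subSum w pw refl) with mask-map⁺ D w
  ... | w′ , ≡weight , ≡sum = subSum w′ (subst P (sym ≡weight) pw) ≡sum

  SubSum-map⁻ : ∀ {P} (D : List (Pt (length S))) {v} → SubSum P (map φ D) v → ∃ λ u → SubSum P D u × φ u ≡ v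
  SubSum-map⁻ {P} D (subSum w′ pw refl) with mask-map⁻ D w′
  ... | w , ≡weight , ≡sum = maskSum D w , subSum w (subst P (sym ≡weight) pw) refl , ≡sum

  parity-maskSum : ∀ {D : List (Pt (length S))} → All (Odd ∘ weight) D → ∀ w → parity (weight (maskSum D w)) ≡ parity (weight w)
  parity-maskSum [] [] = cong parity (weight-𝟎 (length S))
  parity-maskSum {d ∷ D} (odd ∷ D-odd) (a ∷ w) = begin
    parity (weight (a · d ⊕ maskSum D w))                    ≡⟨ parity-weight-⊕ (a · d) (maskSum D w) ⟩
    parity (weight (a · d)) +ℙ parity (weight (maskSum D w))  ≡⟨ cong₂ _+ℙ_ (parity-· a) (parity-maskSum D-odd w) ⟩
    parity (bit a) +ℙ parity (weight w)                       ≡⟨ +-homo-+ (bit a) (weight w) ⟨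
    parity (bit a + weight w)                                 ∎
    where
      open ≡-Reasoning
      parity-· : ∀ a → parity (weight (a · d)) ≡ parity (bit a)
      parity-· true = odd
      parity-· false = cong parity (weight-𝟎 (length S))

  module _ (S! : Indep S) {D : List (Pt (length S))} (D-odd : All (Odd ∘ weight) D) where

    SubSum-from-coordinates : ∀ {P} → (∀ {k} → P k → Even k) → SubSum P (map φ D) 𝟎 → SubSum P D 𝟎
    SubSum-from-coordinates P⇒Even dep with SubSum-map⁻ D dep
    ... | u , subSum w pw refl , φu≡𝟎 =
      subSum w pw (Indep⇒injective S! (maskSum D w) 𝟎 same-parity (trans φu≡𝟎 (sym (maskSum-𝟎 S))))
      where
        same-parity : parity (weight (maskSum D w)) ≡ parity (weight (𝟎 {length S}))
        same-parity = trans (parity-maskSum D-odd w) (trans (P⇒Even pw) (sym (cong parity (weight-𝟎 (length S)))))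

    SubSum-to-coordinates : ∀ {P} → SubSum P D 𝟎 → SubSum P (map φ D) 𝟎
    SubSum-to-coordinates dep = subst (SubSum _ (map φ D)) (maskSum-𝟎 S) (SubSum-map⁺ D dep)

    Indep-to-coordinates : Indep D → Indep (map φ D)
    Indep-to-coordinates D! = D! ∘ SubSum-from-coordinates proj₁

    Indep-from-coordinates : Indep (map φ D) → Indep D
    Indep-from-coordinates φD! = φD! ∘ SubSum-to-coordinates

    ∈-from-coordinates : ∀ {m} → Odd (weight m) → φ m ∈ map φ D → m ∈ D
    ∈-from-coordinates odd φm∈ with ∈-map⁻ φ φm∈
    ... | d , d∈D , φm≡φd = subst (_∈ D) (sym (Indep⇒injective S! _ d (trans odd (sym (All.lookup D-odd d∈D))) φm≡φd)) d∈D

    𝟙-∉-coordinates : ∀ {m} → Odd (weight m) → 𝟙 (φ m ∉? map φ D) ≡ 𝟙 (m ∉? D)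
    𝟙-∉-coordinates odd =
      𝟙-cong (_ ∉? _) (_ ∉? _) (λ φm∉ → φm∉ ∘ ∈-map⁺ φ) (λ m∉ → m∉ ∘ ∈-from-coordinates odd)

-- Computations in ℤ₂⁷

E7 : List (Pt 7)
E7 = units 7

maskSum-E7 : ∀ w → maskSum E7 w ≡ w
maskSum-E7 w = All.lookup (toWitness {a? = All.all? (λ w → maskSum E7 w ≟P w) (allPts 7)} _) (allPts-complete w)

-- maskSum E7 is the identity, so a vanishing subfamily sum of m ∷ m′ ∷ E7 is determined by which of m, m′ it uses.
module _ {m m′ : Pt 7} where

  dependency-shape : ∀ {P} → SubSum P (m ∷ m′ ∷ E7) 𝟎 → ∃₂ λ a b → P (weight (a ∷ b ∷ a · m ⊕ b · m′))
  dependency-shape {P} (subSum (a ∷ b ∷ w) pw sum≡𝟎) = a , b , subst (λ u → P (weight (a ∷ b ∷ u))) w≡ pw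
    where
      w≡ : w ≡ a · m ⊕ b · m′
      w≡ = sym (⊕≡𝟎⇒≡ (trans (⊕-assoc (a · m) (b · m′) w)
                             (trans (cong (λ z → a · m ⊕ (b · m′ ⊕ z)) (sym (maskSum-E7 w))) sum≡𝟎)))

  dependency-of-shape : ∀ {P} a b → P (weight (a ∷ b ∷ a · m ⊕ b · m′)) → SubSum P (m ∷ m′ ∷ E7) 𝟎
  dependency-of-shape a b pw =
    subSum (a ∷ b ∷ a · m ⊕ b · m′) pw
           (trans (cong (λ z → a · m ⊕ (b · m′ ⊕ z)) (maskSum-E7 (a · m ⊕ b · m′)))
                  (trans (sym (⊕-assoc (a · m) (b · m′) _)) (⊕-self (a · m ⊕ b · m′))))

∃Bool? : {Q : Bool → Set} → (∀ b → Dec (Q b)) → Dec (∃ Q)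
∃Bool? Q? = map′ (λ { (inj₁ q) → true , q ; (inj₂ q) → false , q }) (λ { (true , q) → inj₁ q ; (false , q) → inj₂ q })
                 (Q? true ⊎-dec Q? false)

dependency? : ∀ {P} → (∀ k → Dec (P k)) → (m m′ : Pt 7) → Dec (SubSum P (m ∷ m′ ∷ E7) 𝟎)
dependency? P? m m′ = map′ (λ (a , b , pw) → dependency-of-shape a b pw) dependency-shape
                          (∃Bool? λ a → ∃Bool? λ b → P? (weight (a ∷ b ∷ a · m ⊕ b · m′)))

-- Counts, in coordinates relative to S, the ordered pairs (x, y) of points of aff S outside S
-- such that y ∷ x ∷ S is a cap.
extensionCount : ∀ k → ((m′ m : Pt k) → Dec (SubSum (_≡ 4) (m′ ∷ m ∷ units k) 𝟎)) → ℕ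
extensionCount k dep? =
  ∑[ m ∈ oddMasks k ] ∑[ m′ ∈ oddMasks k ] 𝟙 (m ∉? units k) * (𝟙 (m′ ∉? m ∷ units k) * 𝟙 (¬? (dep? m′ m)))

extensionCount₇ : extensionCount 7 (dependency? (_≟ 4)) ≡ 210
extensionCount₇ = refl

-- m and m′ are the coordinates of the two points of a 9-cap outside an affine basis of it.
SubsetCounts : Set
SubsetCounts = All (λ m → All (λ m′ → ¬ SubSum (_≡ 2) (m ∷ m′ ∷ E7) 𝟎 → ¬ SubSum (_≡ 4) (m ∷ m′ ∷ E7) 𝟎 →
                                   ∑[ T ∈ choose 7 (m ∷ m′ ∷ E7) ] 𝟙 (indep? T) ≡ 27) (oddMasks 7)) (oddMasks 7)

subset-counts : SubsetCounts
subset-counts = toWitness {a? = subset-counts?} _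
  where
    subset-counts? : Dec SubsetCounts
    subset-counts? = All.all? (λ m → All.all? (λ m′ →
      ¬? (dependency? (_≟ 2) m m′) →-dec ¬? (dependency? (_≟ 4) m m′) →-dec
      (∑[ T ∈ choose 7 (m ∷ m′ ∷ E7) ] 𝟙 (indep? T) ≟ 27)) (oddMasks 7)) (oddMasks 7)

-- Transports the computations to ℤ₂ᵏ for a k that is 7 only propositionally, such as length B.
subset-counts-at : ∀ {k} → k ≡ 7 → ∀ {m m′ : Pt k} → Odd (weight m) → Odd (weight m′) →
                ¬ SubSum (_≡ 2) (m ∷ m′ ∷ units k) 𝟎 → ¬ SubSum (_≡ 4) (m ∷ m′ ∷ units k) 𝟎 →
                ∑[ T ∈ choose 7 (m ∷ m′ ∷ units k) ] 𝟙 (indep? T) ≡ 27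
subset-counts-at refl odd odd′ = All.lookup (All.lookup subset-counts (∈-oddMasks odd)) (∈-oddMasks odd′)

extensionCount-at : ∀ {k} → k ≡ 7 → (dep? : ∀ m′ m → Dec (SubSum (_≡ 4) (m′ ∷ m ∷ units k) 𝟎)) →
                    extensionCount k dep? ≡ 210
extensionCount-at refl dep? = trans (∑-cong (oddMasks 7) λ m _ → ∑-cong (oddMasks 7) λ m′ _ →
  cong (λ z → 𝟙 (m ∉? E7) * (𝟙 (m′ ∉? m ∷ E7) * z)) (𝟙-cong (¬? (dep? m′ m)) (¬? (dependency? (_≟ 4) m′ m)) id id))
  extensionCount₇

-- The two counts

length≡2⇒pair : (R : List A) → length R ≡ 2 → ∃₂ λ x y → R ≡ x ∷ y ∷ []
length≡2⇒pair (x ∷ y ∷ []) refl = x , y , refl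

module _ {n : ℕ} where

  private
    Ω = allPts n

  capDim-7-subsets : ∀ {K} → K ∈ choose 9 Ω → CapDim 6 K → ∑[ T ∈ choose 7 K ] 𝟙 (capDim? 6 T) ≡ 27
  capDim-7-subsets {K} K∈ (isCap , dim) with basis-of K | basis-length (basis-of K) (trans (sym (length-aff K)) dim)
  ... | basis R B K↭R++B B! K⊑B _ | |B|≡7 with length≡2⇒pair R |R|≡2
    where
      |R|≡2 : length R ≡ 2
      |R|≡2 = +-cancelʳ-≡ 7 (length R) 2 (begin
        length R + 7         ≡⟨ cong (length R +_) |B|≡7 ⟨
        length R + length B  ≡⟨ length-++ R ⟨
        length (R ++ B)      ≡⟨ ↭-length K↭R++B ⟨
        length K             ≡⟨ choose-length 9 Ω K∈ ⟩
        9                    ∎)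
        where open ≡-Reasoning
  ... | x , y , refl with K⊑B (Aff-∈ (∈-resp-↭ (↭-sym K↭R++B) (here refl)))
                        | K⊑B (Aff-∈ (∈-resp-↭ (↭-sym K↭R++B) (there (here refl))))
  ... | subSum m odd refl | subSum m′ odd′ refl = begin
    ∑[ T ∈ choose 7 K ] 𝟙 (capDim? 6 T)              ≡⟨ ∑-choose-↭ K↭R++B 7 _ (𝟙-capDim-↭ 6) ⟩
    ∑[ T ∈ choose 7 (φ m ∷ φ m′ ∷ B) ] 𝟙 (capDim? 6 T) ≡⟨ cong (λ L → ∑[ T ∈ choose 7 L ] 𝟙 (capDim? 6 T)) map-D ⟨
    ∑[ T ∈ choose 7 (map φ D) ] 𝟙 (capDim? 6 T)      ≡⟨ cong (λ Ts → ∑[ T ∈ Ts ] 𝟙 (capDim? 6 T)) (choose-map φ 7 D) ⟩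
    ∑[ T ∈ map (map φ) (choose 7 D) ] 𝟙 (capDim? 6 T) ≡⟨ ∑-map (map φ) (choose 7 D) _ ⟩
    ∑[ T ∈ choose 7 D ] 𝟙 (capDim? 6 (map φ T))      ≡⟨ ∑-cong (choose 7 D) capDim⇔indep ⟩
    ∑[ T ∈ choose 7 D ] 𝟙 (indep? T)                 ≡⟨ subset-counts-at |B|≡7 odd odd′ no-pair no-quad ⟩
    27                                               ∎
    where
      open ≡-Reasoning
      open Coordinates B
      D : List (Pt (length B))
      D = m ∷ m′ ∷ units (length B)
      D-odd : All (Odd ∘ weight) D
      D-odd = odd ∷ odd′ ∷ units-odd (length B)
      map-D : map φ D ≡ φ m ∷ φ m′ ∷ B
      map-D = cong (λ L → φ m ∷ φ m′ ∷ L) (map-units B)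
      in-K : ∀ {P} → SubSum P D 𝟎 → SubSum P K 𝟎
      in-K {P} = SubSum-↭ (↭-sym K↭R++B) ∘ subst (λ L → SubSum P L 𝟎) map-D ∘ SubSum-to-coordinates B! D-odd
      no-quad : ¬ SubSum (_≡ 4) D 𝟎
      no-quad = IsCap⇒Cap K isCap ∘ in-K
      no-pair : ¬ SubSum (_≡ 2) D 𝟎
      no-pair = Unique⇒¬pair (choose-unique 9 (allPts-unique n) K∈) ∘ in-K
      capDim⇔indep : ∀ T → T ∈ choose 7 D → 𝟙 (capDim? 6 (map φ T)) ≡ 𝟙 (indep? T)
      capDim⇔indep T T∈ = 𝟙-cong (capDim? 6 (map φ T)) (indep? T)
        (Indep-from-coordinates B! T-odd ∘ CapDim⇒Indep 6 (map φ T) |φT|≡7)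
        (Indep⇒CapDim 6 (map φ T) |φT|≡7 ∘ Indep-to-coordinates B! T-odd)
        where
          T-odd = All-resp-⊇ (choose-⊆ 7 D T∈) D-odd
          |φT|≡7 = trans (length-map φ T) (choose-length 7 D T∈)

  extension-in-aff : ∀ {S : List (Pt n)} {x y} → Indep S → length S ≡ 7 → CapDim 6 (y ∷ x ∷ S) → Aff S x × Aff S y
  extension-in-aff {S} {x} {y} S! |S|≡7 (_ , dim) =
    maximal (SubSum-∷ y) , maximal (SubSum-↭ (swap x y ↭-refl) ∘ SubSum-∷ x)
    where
      maximal : ∀ {z} → z ∷ S ⊑ y ∷ x ∷ S → Aff S z
      maximal = aff-maximal S! |S|≡7 (trans (sym (length-aff (y ∷ x ∷ S))) dim)

  capDim-extensions : ∀ {S : List (Pt n)} → Indep S → length S ≡ 7 →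
                ∑[ x ∈ Ω ] 𝟙 (x ∉? S) * (∑[ y ∈ Ω ] 𝟙 (y ∉? x ∷ S) * 𝟙 (capDim? 6 (y ∷ x ∷ S))) ≡ 210
  capDim-extensions {S} S! |S|≡7 = begin
    ∑[ x ∈ Ω ] 𝟙 (x ∉? S) * (∑[ y ∈ Ω ] h x y)
      ≡⟨ ∑-cong Ω (λ x _ → restrict x) ⟩
    ∑[ x ∈ Ω ] 𝟙 (aff? S x) * (𝟙 (x ∉? S) * (∑[ y ∈ Ω ] 𝟙 (aff? S y) * h x y))
      ≡⟨ ∑-aff S! _ ⟩
    ∑[ m ∈ M ] 𝟙 (φ m ∉? S) * (∑[ y ∈ Ω ] 𝟙 (aff? S y) * h (φ m) y)
      ≡⟨ ∑-cong M (λ m _ → cong (𝟙 (φ m ∉? S) *_) (∑-aff S! (h (φ m)))) ⟩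
    ∑[ m ∈ M ] 𝟙 (φ m ∉? S) * (∑[ m′ ∈ M ] h (φ m) (φ m′))
      ≡⟨ ∑-cong M (λ m m∈ → trans (sym (∑-*ˡ (𝟙 (φ m ∉? S)) M (h (φ m) ∘ φ)))
                                  (∑-cong M λ m′ m′∈ → in-coordinates {m} {m′} (odd-of m∈) (odd-of m′∈))) ⟩
    extensionCount (length S) dep?
      ≡⟨ extensionCount-at |S|≡7 dep? ⟩
    210 ∎
    where
      open ≡-Reasoning
      open Coordinates S
      M = oddMasks (length S)
      E = units (length S)
      h : Pt n → Pt n → ℕ
      h x y = 𝟙 (y ∉? x ∷ S) * 𝟙 (capDim? 6 (y ∷ x ∷ S))
      h-support : ∀ x y → h x y ≡ 𝟙 (aff? S x) * (𝟙 (aff? S y) * h x y)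
      h-support x y = begin
        𝟙 (y ∉? x ∷ S) * 𝟙 (capDim? 6 (y ∷ x ∷ S))
          ≡⟨ cong (𝟙 (y ∉? x ∷ S) *_) (𝟙-⇒ (capDim? 6 (y ∷ x ∷ S)) (aff? S x ×-dec aff? S y) (extension-in-aff S! |S|≡7)) ⟩
        𝟙 (y ∉? x ∷ S) * (𝟙 (aff? S x ×-dec aff? S y) * 𝟙 (capDim? 6 (y ∷ x ∷ S)))
          ≡⟨ cong (λ z → 𝟙 (y ∉? x ∷ S) * (z * 𝟙 (capDim? 6 (y ∷ x ∷ S)))) (𝟙-× (aff? S x) (aff? S y)) ⟩
        𝟙 (y ∉? x ∷ S) * ((𝟙 (aff? S x) * 𝟙 (aff? S y)) * 𝟙 (capDim? 6 (y ∷ x ∷ S)))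
          ≡⟨ rearrange (𝟙 (y ∉? x ∷ S)) (𝟙 (aff? S x)) (𝟙 (aff? S y)) (𝟙 (capDim? 6 (y ∷ x ∷ S))) ⟩
        𝟙 (aff? S x) * (𝟙 (aff? S y) * (𝟙 (y ∉? x ∷ S) * 𝟙 (capDim? 6 (y ∷ x ∷ S))))
          ∎
        where
          rearrange : ∀ a b c d → a * ((b * c) * d) ≡ b * (c * (a * d))
          rearrange = solve-∀
      restrict : ∀ x → 𝟙 (x ∉? S) * (∑[ y ∈ Ω ] h x y)
                       ≡ 𝟙 (aff? S x) * (𝟙 (x ∉? S) * (∑[ y ∈ Ω ] 𝟙 (aff? S y) * h x y))
      restrict x = trans (cong (𝟙 (x ∉? S) *_) (trans (∑-cong Ω λ y _ → h-support x y) (∑-*ˡ (𝟙 (aff? S x)) Ω _)))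
                         (CommSemigroup.x∙yz≈y∙xz *-commutativeSemigroup (𝟙 (x ∉? S)) (𝟙 (aff? S x)) _)
      odd-of : ∀ {w} → w ∈ M → Odd (weight w)
      odd-of w∈ = proj₂ (∈-filter⁻ odd? {xs = allPts (length S)} w∈)
      dep? : ∀ m′ m → Dec (SubSum (_≡ 4) (m′ ∷ m ∷ E) 𝟎)
      dep? m′ m = subSum? (_≟ 4) (m′ ∷ m ∷ E) 𝟎
      in-coordinates : ∀ {m m′} → Odd (weight m) → Odd (weight m′) →
                       𝟙 (φ m ∉? S) * h (φ m) (φ m′) ≡ 𝟙 (m ∉? E) * (𝟙 (m′ ∉? m ∷ E) * 𝟙 (¬? (dep? m′ m)))
      in-coordinates {m} {m′} odd odd′ = cong₂ _*_
        (trans (cong (λ L → 𝟙 (φ m ∉? L)) (sym (map-units S))) (𝟙-∉-coordinates S! E-odd odd))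
        (cong₂ _*_ (trans (cong (λ L → 𝟙 (φ m′ ∉? φ m ∷ L)) (sym (map-units S))) (𝟙-∉-coordinates S! (odd ∷ E-odd) odd′))
                   (𝟙-cong (capDim? 6 (φ m′ ∷ φ m ∷ S)) (¬? (dep? m′ m)) (λ capDim → IsCap⇒Cap _ (proj₁ capDim) ∘ in-S)
                           (CapDim-extension S! |S|≡7 (subSum m odd refl) (subSum m′ odd′ refl) ∘ from-S)))
        where
          E-odd = units-odd (length S)
          D = m′ ∷ m ∷ E
          map-D : map φ D ≡ φ m′ ∷ φ m ∷ S
          map-D = cong (λ L → φ m′ ∷ φ m ∷ L) (map-units S)
          in-S : SubSum (_≡ 4) D 𝟎 → SubSum (_≡ 4) (φ m′ ∷ φ m ∷ S) 𝟎
          in-S = subst (λ L → SubSum (_≡ 4) L 𝟎) map-D ∘ SubSum-to-coordinates S! (odd′ ∷ odd ∷ E-odd)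
          from-S : ¬ SubSum (_≡ 4) D 𝟎 → Cap (φ m′ ∷ φ m ∷ S)
          from-S no-quad = no-quad ∘ SubSum-from-coordinates S! (odd′ ∷ odd ∷ E-odd) (λ { refl → refl })
                                   ∘ subst (λ L → SubSum (_≡ 4) L 𝟎) (sym map-D)

  capDim-9-supersets : ∀ {S} → S ∈ choose 7 Ω → CapDim 6 S → ∑[ K ∈ choose 9 Ω ] 𝟙 (S ⊆? K) * 𝟙 (capDim? 6 K) ≡ 105
  capDim-9-supersets {S} S∈ S-ok = *-cancelˡ-≡ _ 105 2 (begin
    2 * (∑[ K ∈ choose 9 Ω ] 𝟙 (S ⊆? K) * 𝟙 (capDim? 6 K))
      ≡⟨ ∑-supersets-by-two _≟P_ 7 (𝟙 ∘ capDim? 6) (𝟙-capDim-↭ 6) (allPts-unique n) S∈ ⟩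
    ∑[ x ∈ Ω ] 𝟙 (x ∉? S) * (∑[ y ∈ Ω ] 𝟙 (y ∉? x ∷ S) * 𝟙 (capDim? 6 (y ∷ x ∷ S)))
      ≡⟨ capDim-extensions (CapDim⇒Indep 6 S |S|≡7 S-ok) |S|≡7 ⟩
    210 ∎)
    where
      open ≡-Reasoning
      |S|≡7 = choose-length 7 Ω S∈

theorem7p6 : (n : ℕ) → 9 * Q 6 9 n ≡ 35 * Q 6 7 n
theorem7p6 n = *-cancelˡ-≡ (9 * Q 6 9 n) (35 * Q 6 7 n) 3 (begin
  3 * (9 * Q 6 9 n)   ≡⟨ *-assoc 3 9 (Q 6 9 n) ⟨
  27 * Q 6 9 n        ≡⟨ double-counting (capDim? 6) (capDim? 6) (λ K S → 𝟙 (S ⊆? K)) (choose 9 Ω) (choose 7 Ω)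
                                         {27} {105} row column ⟩
  105 * Q 6 7 n       ≡⟨ *-assoc 3 35 (Q 6 7 n) ⟩
  3 * (35 * Q 6 7 n)  ∎)
  where
    open ≡-Reasoning
    Ω = allPts n
    row : ∀ K → K ∈ choose 9 Ω → CapDim 6 K → ∑[ S ∈ choose 7 Ω ] 𝟙 (S ⊆? K) * 𝟙 (capDim? 6 S) ≡ 27
    row K K∈ K-ok = trans (∑-choose-⊆ _≟P_ 7 9 (𝟙 ∘ capDim? 6) (allPts-unique n) K∈) (capDim-7-subsets K∈ K-ok)
    column : ∀ S → S ∈ choose 7 Ω → CapDim 6 S → ∑[ K ∈ choose 9 Ω ] 𝟙 (S ⊆? K) * 𝟙 (capDim? 6 K) ≡ 105
    column S S∈ S-ok = capDim-9-supersets S∈ S-ok
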